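{- Let $a$ be an integer and $p$ an odd prime with $p\nmid a(a^4-1)$. Let $\{u_n\}_{n\geq0}$ be the Lucas sequence defined by $u_0=0$, $u_1=1$, $u_{n+1}=2u_n-(a^2+1)u_{n-1}$ for $n\geq1$. For an integer $r$ put $K_{p,4,r}(a)=\sum_{1\le k\le p-1,\ k\equiv r\ (\mathrm{mod}\ 4)}\frac{(-a)^k}{k}$. Then, if $p\equiv1\pmod4$, $$\frac{u_{p-1}}{p}\equiv\frac{2}{a(a^2+1)}\big(aK_{p,4,0}(a)-K_{p,4,1}(a)\big)+\frac{2}{a^2+1}q_p(a)+\frac{a^2-1}{2a(a^2+1)}\big(q_p(a+1)-q_p(a-1)\big)\pmod p;$$ and if $p\equiv3\pmod4$, $$\frac{u_{p+1}}{p}\equiv-\frac{2}{a}\big(aK_{p,4,0}(a)+K_{p,4,1}(a)\big)-\frac{(a+1)^2}{2a}q_p(a+1)+\frac{(a-1)^2}{2a}q_p(a-1)\pmod p.$$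
   Context: For an odd prime $p$ and an integer $x$ with $p\nmid x$, $q_p(x)=\frac{x^{p-1}-1}{p}$ is the Fermat quotient. Congruences modulo $p$ between rational numbers with denominators prime to $p$ are understood in the ring of $p$-integral rationals. -}

module Defs where

open import Data.Nat as ℕ using (ℕ; zero; suc; _%_)
open import Data.Integer as ℤ using (ℤ; +_; -[1+_])
open import Data.Rational as ℚ using (ℚ; ↥_; ↧ₙ_)
open import Data.Nat.Divisibility as ℕD using ()
open import Relation.Binary.PropositionalEquality using (_≡_)
open import Relation.Nullary using (¬_; yes; no)

-- The rational number n/d for integers n, d (convention: n/0 := 0;
-- only used with nonzero denominators under the hypotheses).
frac : ℤ → ℤ → ℚ
frac n (+ zero)    = ℚ.0ℚ
frac n (+ suc d)   = n ℚ./ suc d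
frac n -[1+ d ]    = (ℤ.- n) ℚ./ suc d

-- Congruence modulo p in the ring of p-integral rationals:
-- x ≡ y (mod p) iff x - y, written in lowest terms, has numerator
-- divisible by p and denominator prime to p.
_≡_[modℚ_] : ℚ → ℚ → ℕ → Set
x ≡ y [modℚ p ] =
  (p ℕD.∣ ℤ.∣ ↥ (x ℚ.- y) ∣) × ¬ (p ℕD.∣ ↧ₙ (x ℚ.- y))
  where open import Data.Product using (_×_)

q : ℕ → ℤ → ℚ
q p x = frac (x ℤ.^ (p ℕ.∸ 1) ℤ.- ℤ.1ℤ) (+ p)

u : ℤ → ℕ → ℤ
u a zero = ℤ.0ℤ
u a (suc zero) = ℤ.1ℤ
u a (suc (suc n)) = + 2 ℤ.* u a (suc n) ℤ.- (a ℤ.* a ℤ.+ ℤ.1ℤ) ℤ.* u a n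

Ksum : ℤ → ℕ → ℕ → ℚ
Ksum a r zero = ℚ.0ℚ
Ksum a r (suc m) with (suc m) % 4 ℕ.≟ r % 4
... | yes _ = Ksum a r m ℚ.+ frac ((ℤ.- a) ℤ.^ suc m) (+ suc m)
... | no _  = Ksum a r m

K : ℕ → ℕ → ℤ → ℚ
K p r a = Ksum a r (p ℕ.∸ 1)

-- The binomial expansions of (1 + a)ᵖ, (1 - a)ᵖ and (1 + ia)ᵖ = (uₚ₊₁ - uₚ) + i a uₚ, with their
-- middle terms grouped by k mod 4 into Aᵣ = Σ_{0<k<p, k≡r (4)} C(p,k) aᵏ, express 2a(a²+1) uₚ₋₁
-- (p ≡ 1) resp. 2a uₚ₊₁ (p ≡ 3) as an integer combination of aᵖ⁻¹ - 1, (a ± 1)ᵖ⁻¹ - 1, A₀ and A₁.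
-- Dividing by p gives an exact identity in ℚ, and Aᵣ/p ≡ -K_{p,4,r}(a) (mod p) because
-- C(p,k)/p = C(p-1,k-1)/k ≡ (-1)ᵏ⁻¹/k.

module Submission where

open import Defs
open import Data.Nat as ℕ using (ℕ; _%_)
open import Data.Nat.Primality using (Prime)
open import Data.Integer as ℤ using (ℤ; +_)
open import Data.Integer.Divisibility as ℤD using ()
open import Data.Rational as ℚ using (ℚ)
open import Data.Product using (_×_)
open import Relation.Binary.PropositionalEquality using (_≡_; _≢_)
open import Relation.Nullary using (¬_)

open import Data.Integer using (-[1+_]; _+_; _-_; _*_; -_; _^_; 0ℤ; 1ℤ; -1ℤ)
import Data.Integer.Properties as ℤ
open import Algebra.Properties.CommutativeSemigroup ℤ.+-commutativeSemigroup
  using () renaming (interchange to +-interchange)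
open import Algebra.Properties.CommutativeSemigroup ℤ.*-commutativeSemigroup
  using (x∙yz≈y∙xz)
open import Data.Integer.Divisibility.Signed
  using (_∣_; divides; ∣ᵤ⇒∣; ∣⇒∣ᵤ; ∣m∣n⇒∣m+n; ∣m⇒∣-m; ∣m∣n⇒∣m-n; ∣n⇒∣m*n; ∣m⇒∣m*n)
open import Data.Integer.Tactic.RingSolver using (solve; solve-∀)
open import Data.List using (_∷_; [])
open import Data.Nat using (zero; suc; z≤n; s≤s)
open import Data.Nat.Combinatorics using (_C_; nCk+nC[k+1]≡[n+1]C[k+1]; nCn≡1; nC1≡n; k>n⇒nCk≡0)
open import Data.Nat.Coprimality using (recompute)
import Data.Nat.Divisibility as ℕ
open import Data.Nat.DivMod using ([m+n]%n≡m%n; m%n<n)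
open import Data.Nat.Primality using (euclidsLemma; prime⇒nonTrivial)
import Data.Nat.Properties as ℕ
import Data.Nat.Tactic.RingSolver as ℕ-Solver
open import Data.Product using (_,_; proj₁; proj₂)
open import Data.Rational using (mkℚ; 0ℚ; 1ℚ)
import Data.Rational.Properties as ℚ
open import Data.Rational.Unnormalised as ℚᵘ using (mkℚᵘ; *≡*; _≃_)
import Data.Rational.Unnormalised.Properties as ℚᵘ
open import Data.Sum using (_⊎_; inj₁; inj₂)
open import Relation.Binary.PropositionalEquality
open import Relation.Nullary using (contradiction; Dec; yes; no)
open import Relation.Nullary.Decidable using (dec⇒maybe)
import Tactic.RingSolver as RingSolver
open import Tactic.RingSolver.Core.AlmostCommutativeRing using (AlmostCommutativeRing; fromCommutativeRing)

p∣m*n⇒p∣m⊎p∣n : ∀ {p} → Prime p → ∀ {m n} → + p ∣ m * n → + p ∣ m ⊎ + p ∣ n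
p∣m*n⇒p∣m⊎p∣n {p} p-prime {m} {n} p∣mn
  with euclidsLemma ℤ.∣ m ∣ ℤ.∣ n ∣ p-prime (subst (p ℕ.∣_) (ℤ.abs-* m n) (∣⇒∣ᵤ p∣mn))
... | inj₁ p∣m = inj₁ (∣ᵤ⇒∣ p∣m)
... | inj₂ p∣n = inj₂ (∣ᵤ⇒∣ p∣n)

p∤m∧p∤n⇒p∤m*n : ∀ {p} → Prime p → ∀ {m n} → ¬ + p ∣ m → ¬ + p ∣ n → ¬ + p ∣ m * n
p∤m∧p∤n⇒p∤m*n p-prime p∤m p∤n p∣mn with p∣m*n⇒p∣m⊎p∣n p-prime p∣mn
... | inj₁ p∣m = p∤m p∣m
... | inj₂ p∣n = p∤n p∣n

p∤1 : ∀ {p} → Prime p → ¬ + p ∣ 1ℤ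
p∤1 p-prime p∣1 = ℕ.nonTrivial⇒≢1 {{prime⇒nonTrivial p-prime}} (ℕ.∣1⇒≡1 (∣⇒∣ᵤ p∣1))

p∤⇒≢0 : ∀ {p n} → ¬ + p ∣ n → n ≢ 0ℤ
p∤⇒≢0 p∤0 refl = p∤0 (divides 0ℤ refl)

p∤2 : ∀ {p} → Prime p → p ≢ 2 → ¬ + p ∣ + 2
p∤2 {2}                   _ p≢2 _   = p≢2 refl
p∤2 {suc (suc (suc _))}   _ _   p∣2 with ℕ.∣⇒≤ (∣⇒∣ᵤ p∣2)
... | s≤s (s≤s ())

p∤a[a⁴-1]⇒p∤a : ∀ {p} a → ¬ + p ℤD.∣ a * (a ^ 4 - 1ℤ) → ¬ + p ∣ a
p∤a[a⁴-1]⇒p∤a a p∤a[a⁴-1] p∣a = p∤a[a⁴-1] (∣⇒∣ᵤ (∣m⇒∣m*n (a ^ 4 - 1ℤ) p∣a))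

p∤a[a⁴-1]⇒p∤a²+1 : ∀ {p} a → ¬ + p ℤD.∣ a * (a ^ 4 - 1ℤ) → ¬ + p ∣ a * a + 1ℤ
p∤a[a⁴-1]⇒p∤a²+1 {p} a p∤a[a⁴-1] p∣a²+1 =
  p∤a[a⁴-1] (∣⇒∣ᵤ (subst (+ p ∣_) (factor a) (∣n⇒∣m*n a (∣m⇒∣m*n ((a + 1ℤ) * (a - 1ℤ)) p∣a²+1))))
  where
  factor : ∀ x → x * ((x * x + 1ℤ) * ((x + 1ℤ) * (x - 1ℤ))) ≡ x * (x * (x * (x * (x * 1ℤ))) - 1ℤ)
  factor = solve-∀

[k+1]*[n+1]C[k+1]≡[n+1]*nCk : ∀ n k → suc k ℕ.* (suc n C suc k) ≡ suc n ℕ.* (n C k)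
[k+1]*[n+1]C[k+1]≡[n+1]*nCk zero    zero    = refl
[k+1]*[n+1]C[k+1]≡[n+1]*nCk zero    (suc k) =
  trans (cong (suc (suc k) ℕ.*_) (k>n⇒nCk≡0 {1} {suc (suc k)} (s≤s (s≤s z≤n))))
        (trans (ℕ.*-zeroʳ (suc (suc k))) (sym (cong (1 ℕ.*_) (k>n⇒nCk≡0 {0} {suc k} (s≤s z≤n)))))
[k+1]*[n+1]C[k+1]≡[n+1]*nCk (suc n) zero    =
  trans (ℕ.*-identityˡ _) (trans (nC1≡n (suc (suc n))) (sym (ℕ.*-identityʳ (suc (suc n)))))
[k+1]*[n+1]C[k+1]≡[n+1]*nCk (suc n) (suc k) = begin
  suc (suc k) ℕ.* (suc (suc n) C suc (suc k))
    ≡⟨ cong (suc (suc k) ℕ.*_) (nCk+nC[k+1]≡[n+1]C[k+1] (suc n) (suc k)) ⟨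
  suc (suc k) ℕ.* (c ℕ.+ c′)
    ≡⟨ split (suc k) c c′ ⟩
  c ℕ.+ (suc k ℕ.* c ℕ.+ suc (suc k) ℕ.* c′)
    ≡⟨ cong₂ (λ x y → c ℕ.+ (x ℕ.+ y))
         ([k+1]*[n+1]C[k+1]≡[n+1]*nCk n k) ([k+1]*[n+1]C[k+1]≡[n+1]*nCk n (suc k)) ⟩
  c ℕ.+ (suc n ℕ.* (n C k) ℕ.+ suc n ℕ.* (n C suc k))
    ≡⟨ cong (c ℕ.+_) (ℕ.*-distribˡ-+ (suc n) (n C k) (n C suc k)) ⟨
  c ℕ.+ suc n ℕ.* (n C k ℕ.+ n C suc k)
    ≡⟨ cong (λ x → c ℕ.+ suc n ℕ.* x) (nCk+nC[k+1]≡[n+1]C[k+1] n k) ⟩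
  suc (suc n) ℕ.* c ∎
  where
  open ≡-Reasoning
  c  = suc n C suc k
  c′ = suc n C suc (suc k)
  split : ∀ j x y → suc j ℕ.* (x ℕ.+ y) ≡ x ℕ.+ (j ℕ.* x ℕ.+ suc j ℕ.* y)
  split = ℕ-Solver.solve-∀

p∣pC[k+1] : ∀ {p} → Prime p → ∀ k → suc k ℕ.< p → p ℕ.∣ p C suc k
p∣pC[k+1] {suc n} p-prime k k<p
  with euclidsLemma (suc k) (suc n C suc k) p-prime
         (subst (suc n ℕ.∣_) (sym ([k+1]*[n+1]C[k+1]≡[n+1]*nCk n k)) (ℕ.m∣m*n (n C k)))
... | inj₁ p∣k+1 = contradiction (ℕ.∣⇒≤ p∣k+1) (ℕ.<⇒≱ k<p)
... | inj₂ p∣C   = p∣C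

p∣[p-1]Ck-[-1]^k : ∀ {n} → Prime (suc n) → ∀ {k} → k ℕ.≤ n →
                 + suc n ∣ + (n C k) - -1ℤ ^ k
p∣[p-1]Ck-[-1]^k p-prime {zero}  _   = divides 0ℤ refl
p∣[p-1]Ck-[-1]^k {n} p-prime {suc k} k<n =
  subst (+ suc n ∣_) pascal
        (∣m∣n⇒∣m-n (∣ᵤ⇒∣ {i = + (suc n C suc k)} (p∣pC[k+1] p-prime k (s≤s k<n)))
                   (p∣[p-1]Ck-[-1]^k p-prime (ℕ.<⇒≤ k<n)))
  where
  open ≡-Reasoning
  s = -1ℤ ^ k
  x = + (n C k)
  y = + (n C suc k)
  pascal : + (suc n C suc k) - (x - s) ≡ y - -1ℤ * s
  pascal = begin
    + (suc n C suc k) - (x - s)       ≡⟨ cong (λ c → + c - (x - s)) (nCk+nC[k+1]≡[n+1]C[k+1] n k) ⟨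
    + (n C k ℕ.+ n C suc k) - (x - s) ≡⟨ cong (ℤ._- (x - s)) (ℤ.pos-+ (n C k) (n C suc k)) ⟩
    (x + y) - (x - s)                 ≡⟨ regroup x y s ⟩
    y - -1ℤ * s                       ∎
    where
    regroup : ∀ x y s → (x + y) - (x - s) ≡ y - -1ℤ * s
    regroup = solve-∀

∑₁ : ℕ → (ℕ → ℤ) → ℤ
∑₁ zero    f = 0ℤ
∑₁ (suc m) f = ∑₁ m f + f (suc m)

∑₀ : ℕ → (ℕ → ℤ) → ℤ
∑₀ m f = f 0 + ∑₁ m f

∑₁-cong : ∀ m {f g} → (∀ k → f k ≡ g k) → ∑₁ m f ≡ ∑₁ m g
∑₁-cong zero    f≡g = refl
∑₁-cong (suc m) f≡g = cong₂ ℤ._+_ (∑₁-cong m f≡g) (f≡g (suc m))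

∑₁-+ : ∀ m f g → ∑₁ m (λ k → f k + g k) ≡ ∑₁ m f + ∑₁ m g
∑₁-+ zero    f g = refl
∑₁-+ (suc m) f g = trans (cong (ℤ._+ (f (suc m) + g (suc m))) (∑₁-+ m f g))
                         (+-interchange (∑₁ m f) (∑₁ m g) (f (suc m)) (g (suc m)))

∑₁-* : ∀ m x f → ∑₁ m (λ k → x * f k) ≡ x * ∑₁ m f
∑₁-* zero    x f = sym (ℤ.*-zeroʳ x)
∑₁-* (suc m) x f = trans (cong (ℤ._+ (x * f (suc m))) (∑₁-* m x f))
                         (sym (ℤ.*-distribˡ-+ x (∑₁ m f) (f (suc m))))

∑₁-shift : ∀ m f → ∑₁ (suc m) f ≡ ∑₀ m (λ k → f (suc k))
∑₁-shift zero    f = ℤ.+-comm 0ℤ (f 1)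
∑₁-shift (suc m) f = trans (cong (ℤ._+ f (suc (suc m))) (∑₁-shift m f))
                           (ℤ.+-assoc (f 1) (∑₁ m (λ k → f (suc k))) (f (suc (suc m))))

∑₀-cong : ∀ m {f g} → (∀ k → f k ≡ g k) → ∑₀ m f ≡ ∑₀ m g
∑₀-cong m f≡g = cong₂ ℤ._+_ (f≡g 0) (∑₁-cong m f≡g)

∑₀-+ : ∀ m f g → ∑₀ m (λ k → f k + g k) ≡ ∑₀ m f + ∑₀ m g
∑₀-+ m f g = trans (cong (_+_ (f 0 + g 0)) (∑₁-+ m f g))
                   (+-interchange (f 0) (g 0) (∑₁ m f) (∑₁ m g))

∑₀-* : ∀ m x f → ∑₀ m (λ k → x * f k) ≡ x * ∑₀ m f
∑₀-* m x f = trans (cong (_+_ (x * f 0)) (∑₁-* m x f))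
                   (sym (ℤ.*-distribˡ-+ x (f 0) (∑₁ m f)))

binomialSum : ℕ → (ℕ → ℤ) → ℤ
binomialSum n f = ∑₀ n (λ k → + (n C k) * f k)

binomialSum-cong : ∀ n {f g} → (∀ k → f k ≡ g k) → binomialSum n f ≡ binomialSum n g
binomialSum-cong n f≡g = ∑₀-cong n (λ k → cong (_*_ (+ (n C k))) (f≡g k))

binomialSum-* : ∀ n x f → binomialSum n (λ k → x * f k) ≡ x * binomialSum n f
binomialSum-* n x f = trans (∑₀-cong n (λ k → x∙yz≈y∙xz (+ (n C k)) x (f k))) (∑₀-* n x _)

binomialSum-pascal : ∀ n f → binomialSum (suc n) f ≡ binomialSum n f + binomialSum n (λ k → f (suc k))
binomialSum-pascal n f = begin
  binomialSum (suc n) f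
    ≡⟨ cong (_+_ f₀) (∑₁-shift n (λ k → + (suc n C k) * f k)) ⟩
  f₀ + ∑₀ n (λ k → + (suc n C suc k) * f (suc k))
    ≡⟨ cong (_+_ f₀) (∑₀-cong n pascal) ⟩
  f₀ + ∑₀ n (λ k → + (n C k) * f (suc k) + + (n C suc k) * f (suc k))
    ≡⟨ cong (_+_ f₀) (∑₀-+ n (λ k → + (n C k) * f (suc k)) (λ k → + (n C suc k) * f (suc k))) ⟩
  f₀ + (binomialSum n (λ k → f (suc k)) + ∑₀ n (λ k → + (n C suc k) * f (suc k)))
    ≡⟨ cong (λ s → f₀ + (binomialSum n (λ k → f (suc k)) + s)) (∑₁-shift n g) ⟨
  f₀ + (binomialSum n (λ k → f (suc k)) + (∑₁ n g + + (n C suc n) * f (suc n)))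
    ≡⟨ cong (λ c → f₀ + (binomialSum n (λ k → f (suc k)) + (∑₁ n g + + c * f (suc n))))
            (k>n⇒nCk≡0 (ℕ.n<1+n n)) ⟩
  f₀ + (binomialSum n (λ k → f (suc k)) + (∑₁ n g + 0ℤ))
    ≡⟨ regroup f₀ (binomialSum n (λ k → f (suc k))) (∑₁ n g) ⟩
  binomialSum n f + binomialSum n (λ k → f (suc k)) ∎
  where
  open ≡-Reasoning
  f₀ = 1ℤ * f 0
  g = λ k → + (n C k) * f k
  pascal : ∀ k → + (suc n C suc k) * f (suc k) ≡ + (n C k) * f (suc k) + + (n C suc k) * f (suc k)
  pascal k = trans (cong (λ c → + c * f (suc k)) (sym (nCk+nC[k+1]≡[n+1]C[k+1] n k)))
                   (trans (cong (ℤ._* f (suc k)) (ℤ.pos-+ (n C k) (n C suc k)))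
                          (ℤ.*-distribʳ-+ (f (suc k)) (+ (n C k)) (+ (n C suc k))))
  regroup : ∀ x y z → x + (y + (z + 0ℤ)) ≡ (x + z) + y
  regroup = solve-∀

binomial-theorem : ∀ x n → binomialSum n (x ^_) ≡ (x + 1ℤ) ^ n
binomial-theorem x zero    = refl
binomial-theorem x (suc n) = begin
  binomialSum (suc n) (x ^_)
    ≡⟨ binomialSum-pascal n (x ^_) ⟩
  binomialSum n (x ^_) + binomialSum n (λ k → x * x ^ k)
    ≡⟨ cong (_+_ (binomialSum n (x ^_))) (binomialSum-* n x (x ^_)) ⟩
  binomialSum n (x ^_) + x * binomialSum n (x ^_)
    ≡⟨ cong (λ y → y + x * y) (binomial-theorem x n) ⟩
  y + x * y
    ≡⟨ factor x y ⟩
  (x + 1ℤ) * y ∎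
  where
  open ≡-Reasoning
  y = (x + 1ℤ) ^ n
  factor : ∀ x y → y + x * y ≡ (x + 1ℤ) * y
  factor = solve-∀

[-x]^n≡[-1]^n*x^n : ∀ x n → (- x) ^ n ≡ -1ℤ ^ n * x ^ n
[-x]^n≡[-1]^n*x^n x zero    = refl
[-x]^n≡[-1]^n*x^n x (suc n) = trans (cong (- x *_) ([-x]^n≡[-1]^n*x^n x n)) (step x (-1ℤ ^ n) (x ^ n))
  where
  step : ∀ x s y → - x * (s * y) ≡ (-1ℤ * s) * (x * y)
  step = solve-∀

re-iᵏ im-iᵏ : ℕ → ℤ
re-iᵏ zero    = 1ℤ
re-iᵏ (suc k) = - im-iᵏ k
im-iᵏ zero    = 0ℤ
im-iᵏ (suc k) = re-iᵏ k

-- (1 + i a)ⁿ = (uₙ₊₁ - uₙ) + i a uₙ, compared coefficientwise.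
binomialSum-lucas : ∀ a n → binomialSum n (λ k → im-iᵏ k * a ^ k) ≡ a * u a n
                          × binomialSum n (λ k → re-iᵏ k * a ^ k) ≡ u a (suc n) - u a n
binomialSum-lucas a zero    = sym (ℤ.*-zeroʳ a) , refl
binomialSum-lucas a (suc n) with binomialSum-lucas a n
... | im≡ , re≡ =
  (begin
    binomialSum (suc n) (λ k → im-iᵏ k * a ^ k)
      ≡⟨ binomialSum-pascal n (λ k → im-iᵏ k * a ^ k) ⟩
    binomialSum n (λ k → im-iᵏ k * a ^ k) + binomialSum n (λ k → re-iᵏ k * (a * a ^ k))
      ≡⟨ cong₂ _+_ im≡ (binomialSum-cong n (λ k → x∙yz≈y∙xz (re-iᵏ k) a (a ^ k))) ⟩
    a * u a n + binomialSum n (λ k → a * (re-iᵏ k * a ^ k))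
      ≡⟨ cong (_+_ (a * u a n)) (trans (binomialSum-* n a _) (cong (a *_) re≡)) ⟩
    a * u a n + a * (u a (suc n) - u a n)
      ≡⟨ imStep a (u a n) (u a (suc n)) ⟩
    a * u a (suc n) ∎)
  ,
  (begin
    binomialSum (suc n) (λ k → re-iᵏ k * a ^ k)
      ≡⟨ binomialSum-pascal n (λ k → re-iᵏ k * a ^ k) ⟩
    binomialSum n (λ k → re-iᵏ k * a ^ k) + binomialSum n (λ k → - im-iᵏ k * (a * a ^ k))
      ≡⟨ cong₂ _+_ re≡ (binomialSum-cong n (λ k → negate (im-iᵏ k) a (a ^ k))) ⟩
    (u a (suc n) - u a n) + binomialSum n (λ k → - a * (im-iᵏ k * a ^ k))
      ≡⟨ cong (_+_ (u a (suc n) - u a n)) (trans (binomialSum-* n (- a) _) (cong (_*_ (- a)) im≡)) ⟩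
    (u a (suc n) - u a n) + - a * (a * u a n)
      ≡⟨ reStep a (u a n) (u a (suc n)) ⟩
    u a (suc (suc n)) - u a (suc n) ∎)
  where
  open ≡-Reasoning
  imStep : ∀ a x y → a * x + a * (y - x) ≡ a * y
  imStep = solve-∀
  negate : ∀ s a x → - s * (a * x) ≡ - a * (s * x)
  negate = solve-∀
  reStep : ∀ a x y → (y - x) + - a * (a * x) ≡ (+ 2 * y - (a * a + 1ℤ) * x) - y
  reStep = solve-∀

Periodic₄ : (ℕ → ℤ) → Set
Periodic₄ w = ∀ k → w (4 ℕ.+ k) ≡ w k

periodic-% : ∀ {w} → Periodic₄ w → ∀ k → w k ≡ w (k % 4)
periodic-% per 0 = refl
periodic-% per 1 = refl
periodic-% per 2 = refl
periodic-% per 3 = refl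
periodic-% {w} per (suc (suc (suc (suc k)))) =
  trans (per k) (trans (periodic-% per k) (cong w (sym 4+k%4≡k%4)))
  where
  4+k%4≡k%4 : (4 ℕ.+ k) % 4 ≡ k % 4
  4+k%4≡k%4 = trans (cong (_% 4) (ℕ.+-comm 4 k)) ([m+n]%n≡m%n k 4)

[-1]^-periodic : Periodic₄ (-1ℤ ^_)
[-1]^-periodic k = fourSigns (-1ℤ ^ k)
  where
  fourSigns : ∀ x → -1ℤ * (-1ℤ * (-1ℤ * (-1ℤ * x))) ≡ x
  fourSigns = solve-∀

re-iᵏ-periodic : Periodic₄ re-iᵏ
re-iᵏ-periodic k = ℤ.neg-involutive (re-iᵏ k)

im-iᵏ-periodic : Periodic₄ im-iᵏ
im-iᵏ-periodic k = ℤ.neg-involutive (im-iᵏ k)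

periodic-at : ∀ {w} → Periodic₄ w → ∀ k {r} → k % 4 ≡ r → w k ≡ w r
periodic-at {w} per k k%4≡r = trans (periodic-% per k) (cong w k%4≡r)

-- The same recursion as Ksum, so that one with-abstraction unfolds both.
classSum : (ℕ → ℤ) → ℕ → ℕ → ℤ
classSum g r zero = 0ℤ
classSum g r (suc m) with suc m % 4 ℕ.≟ r % 4
... | yes _ = classSum g r m + g (suc m)
... | no _  = classSum g r m

indicator : ∀ {A : Set} → Dec A → ℤ
indicator (yes _) = 1ℤ
indicator (no _)  = 0ℤ

classSum-suc : ∀ g r m →
  classSum g r (suc m) ≡ classSum g r m + indicator (suc m % 4 ℕ.≟ r % 4) * g (suc m)
classSum-suc g r m with suc m % 4 ℕ.≟ r % 4
... | yes _ = cong (_+_ (classSum g r m)) (sym (ℤ.*-identityˡ (g (suc m))))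
... | no _  = sym (trans (cong (_+_ (classSum g r m)) (ℤ.*-zeroˡ (g (suc m))))
                         (ℤ.+-identityʳ (classSum g r m)))

⟨_,_⟩₄ : (ℕ → ℤ) → (ℕ → ℤ) → ℤ
⟨ w , c ⟩₄ = w 0 * c 0 + w 1 * c 1 + w 2 * c 2 + w 3 * c 3

⟨,⟩₄-cong : ∀ w {c d} → (∀ j → c j ≡ d j) → ⟨ w , c ⟩₄ ≡ ⟨ w , d ⟩₄
⟨,⟩₄-cong w c≡d =
  cong₂ _+_ (cong₂ _+_ (cong₂ _+_ (cong (w 0 *_) (c≡d 0)) (cong (w 1 *_) (c≡d 1)))
                       (cong (w 2 *_) (c≡d 2)))
            (cong (w 3 *_) (c≡d 3))

⟨,0⟩₄ : ∀ w → ⟨ w , (λ _ → 0ℤ) ⟩₄ ≡ 0ℤ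
⟨,0⟩₄ w = zeros (w 0) (w 1) (w 2) (w 3)
  where
  zeros : ∀ a b c d → a * 0ℤ + b * 0ℤ + c * 0ℤ + d * 0ℤ ≡ 0ℤ
  zeros = solve-∀

⟨,⟩₄-linear : ∀ w c d x → ⟨ w , (λ j → c j + d j * x) ⟩₄ ≡ ⟨ w , c ⟩₄ + ⟨ w , d ⟩₄ * x
⟨,⟩₄-linear w c d x = linear (w 0) (w 1) (w 2) (w 3) (c 0) (c 1) (c 2) (c 3) (d 0) (d 1) (d 2) (d 3) x
  where
  linear : ∀ w₀ w₁ w₂ w₃ c₀ c₁ c₂ c₃ d₀ d₁ d₂ d₃ x →
    w₀ * (c₀ + d₀ * x) + w₁ * (c₁ + d₁ * x) + w₂ * (c₂ + d₂ * x) + w₃ * (c₃ + d₃ * x)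
    ≡ (w₀ * c₀ + w₁ * c₁ + w₂ * c₂ + w₃ * c₃) + (w₀ * d₀ + w₁ * d₁ + w₂ * d₂ + w₃ * d₃) * x
  linear = solve-∀

⟨,indicator⟩₄ : ∀ w {r} → r ℕ.< 4 → ⟨ w , (λ j → indicator (r ℕ.≟ j % 4)) ⟩₄ ≡ w r
⟨,indicator⟩₄ w {0} _ = pick₀ (w 0) (w 1) (w 2) (w 3)
  where
  pick₀ : ∀ a b c d → a * 1ℤ + b * 0ℤ + c * 0ℤ + d * 0ℤ ≡ a
  pick₀ = solve-∀
⟨,indicator⟩₄ w {1} _ = pick₁ (w 0) (w 1) (w 2) (w 3)
  where
  pick₁ : ∀ a b c d → a * 0ℤ + b * 1ℤ + c * 0ℤ + d * 0ℤ ≡ b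
  pick₁ = solve-∀
⟨,indicator⟩₄ w {2} _ = pick₂ (w 0) (w 1) (w 2) (w 3)
  where
  pick₂ : ∀ a b c d → a * 0ℤ + b * 0ℤ + c * 1ℤ + d * 0ℤ ≡ c
  pick₂ = solve-∀
⟨,indicator⟩₄ w {3} _ = pick₃ (w 0) (w 1) (w 2) (w 3)
  where
  pick₃ : ∀ a b c d → a * 0ℤ + b * 0ℤ + c * 0ℤ + d * 1ℤ ≡ d
  pick₃ = solve-∀
⟨,indicator⟩₄ w {suc (suc (suc (suc _)))} (s≤s (s≤s (s≤s (s≤s ()))))

∑₁-periodic : ∀ {w} → Periodic₄ w → ∀ g m →
              ∑₁ m (λ k → w k * g k) ≡ ⟨ w , (λ j → classSum g j m) ⟩₄
∑₁-periodic {w} per g zero = sym (⟨,0⟩₄ w)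
∑₁-periodic {w} per g (suc m) = begin
  ∑₁ m (λ k → w k * g k) + w (suc m) * g (suc m)
    ≡⟨ cong₂ _+_ (∑₁-periodic per g m) (cong (_* g (suc m)) (periodic-% per (suc m))) ⟩
  ⟨ w , (λ j → classSum g j m) ⟩₄ + w r * g (suc m)
    ≡⟨ cong (λ x → ⟨ w , (λ j → classSum g j m) ⟩₄ + x * g (suc m)) (⟨,indicator⟩₄ w (m%n<n (suc m) 4)) ⟨
  ⟨ w , (λ j → classSum g j m) ⟩₄ + ⟨ w , (λ j → indicator (r ℕ.≟ j % 4)) ⟩₄ * g (suc m)
    ≡⟨ ⟨,⟩₄-linear w (λ j → classSum g j m) (λ j → indicator (r ℕ.≟ j % 4)) (g (suc m)) ⟨
  ⟨ w , (λ j → classSum g j m + indicator (r ℕ.≟ j % 4) * g (suc m)) ⟩₄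
    ≡⟨ ⟨,⟩₄-cong w (λ j → sym (classSum-suc g j m)) ⟩
  ⟨ w , (λ j → classSum g j (suc m)) ⟩₄ ∎
  where
  open ≡-Reasoning
  r = suc m % 4

binomialTerm : ℤ → ℕ → ℕ → ℤ
binomialTerm a p k = + (p C k) * a ^ k

-- (-a)ᵏ/k + C(p,k) aᵏ/p multiplied by kp, using k C(p,k) = p C(p-1,k-1).
[-a]ᵏp+C[p,k]aᵏk≡aᵏ[C[p-1,k-1]-[-1]ᵏ⁻¹]p : ∀ a n j →
  (- a) ^ suc j * + suc n + binomialTerm a (suc n) (suc j) * + suc j
  ≡ (a ^ suc j * (+ (n C j) - -1ℤ ^ j)) * + suc n
[-a]ᵏp+C[p,k]aᵏk≡aᵏ[C[p-1,k-1]-[-1]ᵏ⁻¹]p a n j = begin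
  (- a) ^ suc j * + suc n + (+ (suc n C suc j) * a ^ suc j) * + suc j
    ≡⟨ cong (λ y → y * + suc n + (+ (suc n C suc j) * a ^ suc j) * + suc j) ([-x]^n≡[-1]^n*x^n a (suc j)) ⟩
  (-1ℤ * s * x) * + suc n + (+ (suc n C suc j) * x) * + suc j
    ≡⟨ regroup s x (+ (suc n C suc j)) (+ suc j) (+ suc n) ⟩
  (-1ℤ * s * x) * + suc n + x * (+ suc j * + (suc n C suc j))
    ≡⟨ cong (λ c → (-1ℤ * s * x) * + suc n + x * c) absorption ⟩
  (-1ℤ * s * x) * + suc n + x * (+ suc n * + (n C j))
    ≡⟨ factor s x (+ suc n) (+ (n C j)) ⟩
  (x * (+ (n C j) - s)) * + suc n ∎
  where
  open ≡-Reasoning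
  s = -1ℤ ^ j
  x = a ^ suc j
  absorption : + suc j * + (suc n C suc j) ≡ + suc n * + (n C j)
  absorption = trans (sym (ℤ.pos-* (suc j) _))
                     (trans (cong +_ ([k+1]*[n+1]C[k+1]≡[n+1]*nCk n j)) (ℤ.pos-* (suc n) (n C j)))
  regroup : ∀ s x c k p → (-1ℤ * s * x) * p + (c * x) * k ≡ (-1ℤ * s * x) * p + x * (k * c)
  regroup = solve-∀
  factor : ∀ s x p c → (-1ℤ * s * x) * p + x * (p * c) ≡ (x * (c - s)) * p
  factor = solve-∀

binomialClasses : ℤ → ℕ → ℕ → ℤ
binomialClasses a p r = classSum (binomialTerm a p) r (p ℕ.∸ 1)

binomialSum-ends : ∀ n f → binomialSum (suc n) f ≡ f 0 + ∑₁ n (λ k → + (suc n C k) * f k) + f (suc n)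
binomialSum-ends n f = begin
  1ℤ * f 0 + (∑₁ n g + + (suc n C suc n) * f (suc n))
    ≡⟨ cong (λ c → 1ℤ * f 0 + (∑₁ n g + + c * f (suc n))) (nCn≡1 (suc n)) ⟩
  1ℤ * f 0 + (∑₁ n g + 1ℤ * f (suc n))
    ≡⟨ cong₂ (λ x y → x + (∑₁ n g + y)) (ℤ.*-identityˡ (f 0)) (ℤ.*-identityˡ (f (suc n))) ⟩
  f 0 + (∑₁ n g + f (suc n))
    ≡⟨ ℤ.+-assoc (f 0) (∑₁ n g) (f (suc n)) ⟨
  f 0 + ∑₁ n g + f (suc n) ∎
  where
  open ≡-Reasoning
  g = λ k → + (suc n C k) * f k

binomialSum-periodic : ∀ {w} → Periodic₄ w → ∀ a n →
  binomialSum (suc n) (λ k → w k * a ^ k) ≡ w 0 + ⟨ w , binomialClasses a (suc n) ⟩₄ + w (suc n) * a ^ suc n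
binomialSum-periodic {w} per a n = begin
  binomialSum (suc n) (λ k → w k * a ^ k)
    ≡⟨ binomialSum-ends n (λ k → w k * a ^ k) ⟩
  w 0 * 1ℤ + ∑₁ n (λ k → + (suc n C k) * (w k * a ^ k)) + w (suc n) * a ^ suc n
    ≡⟨ cong₂ (λ x y → x + y + w (suc n) * a ^ suc n) (ℤ.*-identityʳ (w 0))
             (∑₁-cong n (λ k → x∙yz≈y∙xz (+ (suc n C k)) (w k) (a ^ k))) ⟩
  w 0 + ∑₁ n (λ k → w k * binomialTerm a (suc n) k) + w (suc n) * a ^ suc n
    ≡⟨ cong (λ x → w 0 + x + w (suc n) * a ^ suc n) (∑₁-periodic per (binomialTerm a (suc n)) n) ⟩
  w 0 + ⟨ w , binomialClasses a (suc n) ⟩₄ + w (suc n) * a ^ suc n ∎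
  where open ≡-Reasoning

-- For Y = aᵖ⁻¹, Y± = (a ± 1)ᵖ⁻¹, u₀ = uₚ₋₁, u₁ = uₚ, the hypotheses are the mod-4 splittings of
-- (1 + a)ᵖ, (1 - a)ᵖ and (1 + ia)ᵖ when p ≡ 1 (mod 4); lucas-identity₃ is the case p ≡ 3.
lucas-identity₁ : ∀ a Y Y₊ Y₋ A₀ A₁ A₂ A₃ u₀ u₁ →
  (a + 1ℤ) * Y₊ ≡ 1ℤ + (A₀ + A₁ + A₂ + A₃) + 1ℤ * (a * Y) →
  (- a + 1ℤ) * Y₋ ≡ 1ℤ + (A₀ - A₁ + A₂ - A₃) + -1ℤ * (a * Y) →
  a * u₁ ≡ 0ℤ + (A₁ - A₃) + 1ℤ * (a * Y) →
  (+ 2 * u₁ - (a * a + 1ℤ) * u₀) - u₁ ≡ 1ℤ + (A₀ - A₂) + 0ℤ * (a * Y) →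
  + 2 * a * (a * a + 1ℤ) * u₀ ≡ + 4 * a * (Y - 1ℤ) + (a * a - 1ℤ) * ((Y₊ - 1ℤ) - (Y₋ - 1ℤ)) + + 4 * (A₁ - a * A₀)
lucas-identity₁ a Y Y₊ Y₋ A₀ A₁ A₂ A₃ u₀ u₁ h₊ h₋ hᵢ hᵣ = begin
  + 2 * a * (a * a + 1ℤ) * u₀
    ≡⟨ solve (a ∷ u₀ ∷ u₁ ∷ []) ⟩
  + 2 * (a * u₁) - + 2 * a * ((+ 2 * u₁ - (a * a + 1ℤ) * u₀) - u₁)
    ≡⟨ cong₂ (λ x y → + 2 * x - + 2 * a * y) hᵢ hᵣ ⟩
  + 2 * (0ℤ + (A₁ - A₃) + 1ℤ * (a * Y)) - + 2 * a * (1ℤ + (A₀ - A₂) + 0ℤ * (a * Y))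
    ≡⟨ solve (a ∷ Y ∷ A₀ ∷ A₁ ∷ A₂ ∷ A₃ ∷ []) ⟩
  + 4 * a * (Y - 1ℤ) + (a - 1ℤ) * (1ℤ + (A₀ + A₁ + A₂ + A₃) + 1ℤ * (a * Y))
    + (a + 1ℤ) * (1ℤ + (A₀ - A₁ + A₂ - A₃) + -1ℤ * (a * Y)) + + 4 * (A₁ - a * A₀)
    ≡⟨ cong₂ (λ x y → + 4 * a * (Y - 1ℤ) + (a - 1ℤ) * x + (a + 1ℤ) * y + + 4 * (A₁ - a * A₀)) h₊ h₋ ⟨
  + 4 * a * (Y - 1ℤ) + (a - 1ℤ) * ((a + 1ℤ) * Y₊) + (a + 1ℤ) * ((- a + 1ℤ) * Y₋) + + 4 * (A₁ - a * A₀)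
    ≡⟨ solve (a ∷ Y ∷ Y₊ ∷ Y₋ ∷ A₀ ∷ A₁ ∷ []) ⟩
  + 4 * a * (Y - 1ℤ) + (a * a - 1ℤ) * ((Y₊ - 1ℤ) - (Y₋ - 1ℤ)) + + 4 * (A₁ - a * A₀) ∎
  where open ≡-Reasoning

lucas-identity₃ : ∀ a Y Y₊ Y₋ A₀ A₁ A₂ A₃ u₀ u₁ →
  (a + 1ℤ) * Y₊ ≡ 1ℤ + (A₀ + A₁ + A₂ + A₃) + 1ℤ * (a * Y) →
  (- a + 1ℤ) * Y₋ ≡ 1ℤ + (A₀ - A₁ + A₂ - A₃) + -1ℤ * (a * Y) →
  a * u₁ ≡ 0ℤ + (A₁ - A₃) + -1ℤ * (a * Y) →
  (+ 2 * u₁ - (a * a + 1ℤ) * u₀) - u₁ ≡ 1ℤ + (A₀ - A₂) + 0ℤ * (a * Y) →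
  + 2 * a * (+ 2 * u₁ - (a * a + 1ℤ) * u₀)
    ≡ (a - 1ℤ) * (a - 1ℤ) * (Y₋ - 1ℤ) - (a + 1ℤ) * (a + 1ℤ) * (Y₊ - 1ℤ) + + 4 * (A₁ + a * A₀)
lucas-identity₃ a Y Y₊ Y₋ A₀ A₁ A₂ A₃ u₀ u₁ h₊ h₋ hᵢ hᵣ = begin
  + 2 * a * (+ 2 * u₁ - (a * a + 1ℤ) * u₀)
    ≡⟨ solve (a ∷ u₀ ∷ u₁ ∷ []) ⟩
  + 2 * (a * u₁) + + 2 * a * ((+ 2 * u₁ - (a * a + 1ℤ) * u₀) - u₁)
    ≡⟨ cong₂ (λ x y → + 2 * x + + 2 * a * y) hᵢ hᵣ ⟩
  + 2 * (0ℤ + (A₁ - A₃) + -1ℤ * (a * Y)) + + 2 * a * (1ℤ + (A₀ - A₂) + 0ℤ * (a * Y))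
    ≡⟨ solve (a ∷ Y ∷ A₀ ∷ A₁ ∷ A₂ ∷ A₃ ∷ []) ⟩
  - (a + 1ℤ) * (1ℤ + (A₀ + A₁ + A₂ + A₃) + 1ℤ * (a * Y)) + (a + 1ℤ) * (a + 1ℤ)
    - (a - 1ℤ) * (1ℤ + (A₀ - A₁ + A₂ - A₃) + -1ℤ * (a * Y)) - (a - 1ℤ) * (a - 1ℤ) + + 4 * (A₁ + a * A₀)
    ≡⟨ cong₂ (λ x y → - (a + 1ℤ) * x + (a + 1ℤ) * (a + 1ℤ) - (a - 1ℤ) * y - (a - 1ℤ) * (a - 1ℤ) + + 4 * (A₁ + a * A₀))
             h₊ h₋ ⟨
  - (a + 1ℤ) * ((a + 1ℤ) * Y₊) + (a + 1ℤ) * (a + 1ℤ)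
    - (a - 1ℤ) * ((- a + 1ℤ) * Y₋) - (a - 1ℤ) * (a - 1ℤ) + + 4 * (A₁ + a * A₀)
    ≡⟨ solve (a ∷ Y₊ ∷ Y₋ ∷ A₀ ∷ A₁ ∷ []) ⟩
  (a - 1ℤ) * (a - 1ℤ) * (Y₋ - 1ℤ) - (a + 1ℤ) * (a + 1ℤ) * (Y₊ - 1ℤ) + + 4 * (A₁ + a * A₀) ∎
  where open ≡-Reasoning

[-1]^[n+1]≡-1⇒[-1]^n≡1 : ∀ n → -1ℤ ^ suc n ≡ -1ℤ → -1ℤ ^ n ≡ 1ℤ
[-1]^[n+1]≡-1⇒[-1]^n≡1 n [-1]^[n+1]≡-1 = ℤ.*-cancelˡ-≡ -1ℤ (-1ℤ ^ n) 1ℤ [-1]^[n+1]≡-1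

module _ (a : ℤ) (n : ℕ) where
  private
    A = binomialClasses a (suc n)

  [a+1]^p≡classes : (a + 1ℤ) ^ suc n ≡ 1ℤ + (A 0 + A 1 + A 2 + A 3) + 1ℤ * a ^ suc n
  [a+1]^p≡classes = begin
    (a + 1ℤ) ^ suc n                               ≡⟨ binomial-theorem a (suc n) ⟨
    binomialSum (suc n) (a ^_)                     ≡⟨ binomialSum-cong (suc n) (λ k → sym (ℤ.*-identityˡ (a ^ k))) ⟩
    binomialSum (suc n) (λ k → 1ℤ * a ^ k)         ≡⟨ binomialSum-periodic {λ _ → 1ℤ} (λ _ → refl) a n ⟩
    1ℤ + ⟨ (λ _ → 1ℤ) , A ⟩₄ + 1ℤ * a ^ suc n      ≡⟨ cong (λ x → 1ℤ + x + 1ℤ * a ^ suc n) (weights (A 0) (A 1) (A 2) (A 3)) ⟩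
    1ℤ + (A 0 + A 1 + A 2 + A 3) + 1ℤ * a ^ suc n ∎
    where
    open ≡-Reasoning
    weights : ∀ x y z t → 1ℤ * x + 1ℤ * y + 1ℤ * z + 1ℤ * t ≡ x + y + z + t
    weights = solve-∀

  [-a+1]^p≡classes : (- a + 1ℤ) ^ suc n ≡ 1ℤ + (A 0 - A 1 + A 2 - A 3) + -1ℤ ^ suc n * a ^ suc n
  [-a+1]^p≡classes = begin
    (- a + 1ℤ) ^ suc n                             ≡⟨ binomial-theorem (- a) (suc n) ⟨
    binomialSum (suc n) ((- a) ^_)                 ≡⟨ binomialSum-cong (suc n) ([-x]^n≡[-1]^n*x^n a) ⟩
    binomialSum (suc n) (λ k → -1ℤ ^ k * a ^ k)    ≡⟨ binomialSum-periodic [-1]^-periodic a n ⟩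
    1ℤ + ⟨ -1ℤ ^_ , A ⟩₄ + -1ℤ ^ suc n * a ^ suc n ≡⟨ cong (λ x → 1ℤ + x + -1ℤ ^ suc n * a ^ suc n) (weights (A 0) (A 1) (A 2) (A 3)) ⟩
    1ℤ + (A 0 - A 1 + A 2 - A 3) + -1ℤ ^ suc n * a ^ suc n ∎
    where
    open ≡-Reasoning
    weights : ∀ x y z t → 1ℤ * x + (-1ℤ * 1ℤ) * y + (-1ℤ * (-1ℤ * 1ℤ)) * z + (-1ℤ * (-1ℤ * (-1ℤ * 1ℤ))) * t
                        ≡ x - y + z - t
    weights = solve-∀

  a*u[p]≡classes : a * u a (suc n) ≡ 0ℤ + (A 1 - A 3) + im-iᵏ (suc n) * a ^ suc n
  a*u[p]≡classes = begin
    a * u a (suc n)                                       ≡⟨ proj₁ (binomialSum-lucas a (suc n)) ⟨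
    binomialSum (suc n) (λ k → im-iᵏ k * a ^ k)           ≡⟨ binomialSum-periodic im-iᵏ-periodic a n ⟩
    0ℤ + ⟨ im-iᵏ , A ⟩₄ + im-iᵏ (suc n) * a ^ suc n       ≡⟨ cong (λ x → 0ℤ + x + im-iᵏ (suc n) * a ^ suc n) (weights (A 0) (A 1) (A 2) (A 3)) ⟩
    0ℤ + (A 1 - A 3) + im-iᵏ (suc n) * a ^ suc n ∎
    where
    open ≡-Reasoning
    weights : ∀ x y z t → 0ℤ * x + 1ℤ * y + (- 0ℤ) * z + (- 1ℤ) * t ≡ y - t
    weights = solve-∀

  u[p+1]-u[p]≡classes : u a (suc (suc n)) - u a (suc n) ≡ 1ℤ + (A 0 - A 2) + re-iᵏ (suc n) * a ^ suc n
  u[p+1]-u[p]≡classes = begin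
    u a (suc (suc n)) - u a (suc n)                       ≡⟨ proj₂ (binomialSum-lucas a (suc n)) ⟨
    binomialSum (suc n) (λ k → re-iᵏ k * a ^ k)           ≡⟨ binomialSum-periodic re-iᵏ-periodic a n ⟩
    1ℤ + ⟨ re-iᵏ , A ⟩₄ + re-iᵏ (suc n) * a ^ suc n       ≡⟨ cong (λ x → 1ℤ + x + re-iᵏ (suc n) * a ^ suc n) (weights (A 0) (A 1) (A 2) (A 3)) ⟩
    1ℤ + (A 0 - A 2) + re-iᵏ (suc n) * a ^ suc n ∎
    where
    open ≡-Reasoning
    weights : ∀ x y z t → 1ℤ * x + (- 0ℤ) * y + (- 1ℤ) * z + (- (- 0ℤ)) * t ≡ x - z
    weights = solve-∀

  [1-a][a-1]^[p-1]≡classes : -1ℤ ^ suc n ≡ -1ℤ →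
    (- a + 1ℤ) * (a - 1ℤ) ^ n ≡ 1ℤ + (A 0 - A 1 + A 2 - A 3) + -1ℤ * (a * a ^ n)
  [1-a][a-1]^[p-1]≡classes [-1]^p≡-1 = begin
    (- a + 1ℤ) * (a - 1ℤ) ^ n
      ≡⟨ cong ((- a + 1ℤ) *_) [a-1]^n≡[-a+1]^n ⟩
    (- a + 1ℤ) ^ suc n
      ≡⟨ [-a+1]^p≡classes ⟩
    1ℤ + (A 0 - A 1 + A 2 - A 3) + -1ℤ ^ suc n * a ^ suc n
      ≡⟨ cong (λ s → 1ℤ + (A 0 - A 1 + A 2 - A 3) + s * a ^ suc n) [-1]^p≡-1 ⟩
    1ℤ + (A 0 - A 1 + A 2 - A 3) + -1ℤ * (a * a ^ n) ∎
    where
    open ≡-Reasoning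
    [a-1]^n≡[-a+1]^n : (a - 1ℤ) ^ n ≡ (- a + 1ℤ) ^ n
    [a-1]^n≡[-a+1]^n = begin
      (a - 1ℤ) ^ n                         ≡⟨ ℤ.*-identityˡ ((a - 1ℤ) ^ n) ⟨
      1ℤ * (a - 1ℤ) ^ n                    ≡⟨ cong (_* (a - 1ℤ) ^ n) ([-1]^[n+1]≡-1⇒[-1]^n≡1 n [-1]^p≡-1) ⟨
      -1ℤ ^ n * (a - 1ℤ) ^ n               ≡⟨ [-x]^n≡[-1]^n*x^n (a - 1ℤ) n ⟨
      (- (a - 1ℤ)) ^ n                     ≡⟨ cong (_^ n) (negate a) ⟩
      (- a + 1ℤ) ^ n                       ∎
      where
      negate : ∀ a → - (a - 1ℤ) ≡ - a + 1ℤ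
      negate = solve-∀

  lucas-identity-p≡1 : suc n % 4 ≡ 1 →
    + 2 * a * (a * a + 1ℤ) * u a n
    ≡ + 4 * a * (a ^ n - 1ℤ) + (a * a - 1ℤ) * (((a + 1ℤ) ^ n - 1ℤ) - ((a - 1ℤ) ^ n - 1ℤ))
      + + 4 * (A 1 - a * A 0)
  lucas-identity-p≡1 p≡1 =
    lucas-identity₁ a (a ^ n) ((a + 1ℤ) ^ n) ((a - 1ℤ) ^ n) (A 0) (A 1) (A 2) (A 3) (u a n) (u a (suc n))
      [a+1]^p≡classes
      ([1-a][a-1]^[p-1]≡classes (periodic-at [-1]^-periodic (suc n) p≡1))
      (trans (a*u[p]≡classes)
             (cong (λ s → 0ℤ + (A 1 - A 3) + s * a ^ suc n) (periodic-at im-iᵏ-periodic (suc n) p≡1)))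
      (trans (u[p+1]-u[p]≡classes)
             (cong (λ s → 1ℤ + (A 0 - A 2) + s * a ^ suc n) (periodic-at re-iᵏ-periodic (suc n) p≡1)))

  lucas-identity-p≡3 : suc n % 4 ≡ 3 →
    + 2 * a * u a (suc (suc n))
    ≡ (a - 1ℤ) * (a - 1ℤ) * ((a - 1ℤ) ^ n - 1ℤ) - (a + 1ℤ) * (a + 1ℤ) * ((a + 1ℤ) ^ n - 1ℤ)
      + + 4 * (A 1 + a * A 0)
  lucas-identity-p≡3 p≡3 =
    lucas-identity₃ a (a ^ n) ((a + 1ℤ) ^ n) ((a - 1ℤ) ^ n) (A 0) (A 1) (A 2) (A 3) (u a n) (u a (suc n))
      [a+1]^p≡classes
      ([1-a][a-1]^[p-1]≡classes (periodic-at [-1]^-periodic (suc n) p≡3))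
      (trans (a*u[p]≡classes)
             (cong (λ s → 0ℤ + (A 1 - A 3) + s * a ^ suc n) (periodic-at im-iᵏ-periodic (suc n) p≡3)))
      (trans (u[p+1]-u[p]≡classes)
             (cong (λ s → 1ℤ + (A 0 - A 2) + s * a ^ suc n) (periodic-at re-iᵏ-periodic (suc n) p≡3)))

ℚ-ring : AlmostCommutativeRing _ _
ℚ-ring = fromCommutativeRing ℚ.+-*-commutativeRing (λ x → dec⇒maybe (0ℚ ℚ.≟ x))

-- frac n 1ℤ reduces to ι n.
ι : ℤ → ℚ
ι n = n ℚ./ 1

private
  toℚᵘ-ι : ∀ n → ℚ.toℚᵘ (ι n) ≃ mkℚᵘ n 0
  toℚᵘ-ι n = ℚ.toℚᵘ-fromℚᵘ (mkℚᵘ n 0)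

ι-+ : ∀ m n → ι (m + n) ≡ ι m ℚ.+ ι n
ι-+ m n = ℚ.toℚᵘ-injective (begin
  ℚ.toℚᵘ (ι (m + n))                  ≈⟨ toℚᵘ-ι (m + n) ⟩
  mkℚᵘ (m + n) 0                      ≈⟨ *≡* (unit m n) ⟩
  mkℚᵘ m 0 ℚᵘ.+ mkℚᵘ n 0             ≈⟨ ℚᵘ.+-cong (toℚᵘ-ι m) (toℚᵘ-ι n) ⟨
  ℚ.toℚᵘ (ι m) ℚᵘ.+ ℚ.toℚᵘ (ι n)     ≈⟨ ℚ.toℚᵘ-homo-+ (ι m) (ι n) ⟨
  ℚ.toℚᵘ (ι m ℚ.+ ι n)                ∎)
  where
  open ℚᵘ.≃-Reasoning
  unit : ∀ m n → (m + n) * + 1 ≡ (m * + 1 + n * + 1) * + 1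
  unit = solve-∀

ι-* : ∀ m n → ι (m * n) ≡ ι m ℚ.* ι n
ι-* m n = ℚ.toℚᵘ-injective (begin
  ℚ.toℚᵘ (ι (m * n))                  ≈⟨ toℚᵘ-ι (m * n) ⟩
  mkℚᵘ (m * n) 0                      ≈⟨ *≡* refl ⟩
  mkℚᵘ m 0 ℚᵘ.* mkℚᵘ n 0             ≈⟨ ℚᵘ.*-cong (toℚᵘ-ι m) (toℚᵘ-ι n) ⟨
  ℚ.toℚᵘ (ι m) ℚᵘ.* ℚ.toℚᵘ (ι n)     ≈⟨ ℚ.toℚᵘ-homo-* (ι m) (ι n) ⟨
  ℚ.toℚᵘ (ι m ℚ.* ι n)                ∎)
  where open ℚᵘ.≃-Reasoning

ι-neg : ∀ n → ι (- n) ≡ ℚ.- ι n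
ι-neg n = ℚ.toℚᵘ-injective (begin
  ℚ.toℚᵘ (ι (- n))          ≈⟨ toℚᵘ-ι (- n) ⟩
  mkℚᵘ (- n) 0              ≈⟨ *≡* refl ⟩
  ℚᵘ.- mkℚᵘ n 0             ≈⟨ ℚᵘ.-‿cong (toℚᵘ-ι n) ⟨
  ℚᵘ.- ℚ.toℚᵘ (ι n)         ≈⟨ ℚ.toℚᵘ-homo‿- (ι n) ⟨
  ℚ.toℚᵘ (ℚ.- ι n)          ∎)
  where open ℚᵘ.≃-Reasoning

ι-≢0 : ∀ n → n ≢ 0ℤ → ι n ≢ 0ℚ
ι-≢0 n n≢0 ιn≡0 with ℚᵘ.≃-trans (ℚᵘ.≃-sym (toℚᵘ-ι n)) (ℚ.toℚᵘ-cong ιn≡0)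
... | *≡* eq = n≢0 (trans (sym (ℤ.*-identityʳ n)) eq)

*-cancelʳ-≢0 : ∀ {x y} c → c ≢ 0ℚ → x ℚ.* c ≡ y ℚ.* c → x ≡ y
*-cancelʳ-≢0 {x} {y} c c≢0 eq = begin
  x                          ≡⟨ cancel x ⟨
  (x ℚ.* c) ℚ.* ℚ.1/ c       ≡⟨ cong (ℚ._* ℚ.1/ c) eq ⟩
  (y ℚ.* c) ℚ.* ℚ.1/ c       ≡⟨ cancel y ⟩
  y                          ∎
  where
  open ≡-Reasoning
  instance _ = ℚ.≢-nonZero c≢0
  cancel : ∀ z → (z ℚ.* c) ℚ.* ℚ.1/ c ≡ z
  cancel z = trans (ℚ.*-assoc z c (ℚ.1/ c)) (trans (cong (z ℚ.*_) (ℚ.*-inverseʳ c)) (ℚ.*-identityʳ z))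

*ι-cancelʳ : ∀ {x y} d → d ≢ 0ℤ → x ℚ.* ι d ≡ y ℚ.* ι d → x ≡ y
*ι-cancelʳ d d≢0 = *-cancelʳ-≢0 (ι d) (ι-≢0 d d≢0)

frac*ι≡ι : ∀ n d → d ≢ 0ℤ → frac n d ℚ.* ι d ≡ ι n
frac*ι≡ι n (+ zero)   d≢0 = contradiction refl d≢0
frac*ι≡ι n (+ suc k)  _   = ℚ.toℚᵘ-injective (begin
  ℚ.toℚᵘ (frac n (+ suc k) ℚ.* ι (+ suc k))            ≈⟨ ℚ.toℚᵘ-homo-* (frac n (+ suc k)) (ι (+ suc k)) ⟩
  ℚ.toℚᵘ (frac n (+ suc k)) ℚᵘ.* ℚ.toℚᵘ (ι (+ suc k))  ≈⟨ ℚᵘ.*-cong (ℚ.toℚᵘ-fromℚᵘ (mkℚᵘ n k)) (toℚᵘ-ι (+ suc k)) ⟩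
  mkℚᵘ n k ℚᵘ.* mkℚᵘ (+ suc k) 0                       ≈⟨ *≡* (trans (unit n (+ suc k)) (cong (λ j → n * + suc j) (sym (ℕ.*-identityʳ k)))) ⟩
  mkℚᵘ n 0                                              ≈⟨ toℚᵘ-ι n ⟨
  ℚ.toℚᵘ (ι n)                                          ∎)
  where
  open ℚᵘ.≃-Reasoning
  unit : ∀ n d → (n * d) * + 1 ≡ n * d
  unit = solve-∀
frac*ι≡ι n -[1+ k ]   _   = ℚ.toℚᵘ-injective (begin
  ℚ.toℚᵘ (frac n -[1+ k ] ℚ.* ι -[1+ k ])              ≈⟨ ℚ.toℚᵘ-homo-* (frac n -[1+ k ]) (ι -[1+ k ]) ⟩
  ℚ.toℚᵘ (frac n -[1+ k ]) ℚᵘ.* ℚ.toℚᵘ (ι -[1+ k ])    ≈⟨ ℚᵘ.*-cong (ℚ.toℚᵘ-fromℚᵘ (mkℚᵘ (- n) k)) (toℚᵘ-ι -[1+ k ]) ⟩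
  mkℚᵘ (- n) k ℚᵘ.* mkℚᵘ -[1+ k ] 0                    ≈⟨ *≡* (trans (unit n (+ suc k)) (cong (λ j → n * + suc j) (sym (ℕ.*-identityʳ k)))) ⟩
  mkℚᵘ n 0                                              ≈⟨ toℚᵘ-ι n ⟨
  ℚ.toℚᵘ (ι n)                                          ∎)
  where
  open ℚᵘ.≃-Reasoning
  unit : ∀ n d → ((- n) * (- d)) * + 1 ≡ n * d
  unit = solve-∀

-- Ring expressions with integer leaves: ι-⟦⟧ moves an integer identity to ℚ in one step.
data Expr : Set where
  ⌜_⌝           : ℤ → Expr
  _⊕_ _⊖_ _⊗_ : Expr → Expr → Expr

infixl 6 _⊕_ _⊖_
infixl 7 _⊗_

⟦_⟧ℤ : Expr → ℤ
⟦ ⌜ n ⌝ ⟧ℤ = n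
⟦ e ⊕ f ⟧ℤ = ⟦ e ⟧ℤ + ⟦ f ⟧ℤ
⟦ e ⊖ f ⟧ℤ = ⟦ e ⟧ℤ - ⟦ f ⟧ℤ
⟦ e ⊗ f ⟧ℤ = ⟦ e ⟧ℤ * ⟦ f ⟧ℤ

⟦_⟧ℚ : Expr → ℚ
⟦ ⌜ n ⌝ ⟧ℚ = ι n
⟦ e ⊕ f ⟧ℚ = ⟦ e ⟧ℚ ℚ.+ ⟦ f ⟧ℚ
⟦ e ⊖ f ⟧ℚ = ⟦ e ⟧ℚ ℚ.- ⟦ f ⟧ℚ
⟦ e ⊗ f ⟧ℚ = ⟦ e ⟧ℚ ℚ.* ⟦ f ⟧ℚ

ι-⟦⟧ : ∀ e → ι ⟦ e ⟧ℤ ≡ ⟦ e ⟧ℚ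
ι-⟦⟧ ⌜ n ⌝   = refl
ι-⟦⟧ (e ⊕ f) = trans (ι-+ ⟦ e ⟧ℤ ⟦ f ⟧ℤ) (cong₂ ℚ._+_ (ι-⟦⟧ e) (ι-⟦⟧ f))
ι-⟦⟧ (e ⊖ f) = trans (ι-+ ⟦ e ⟧ℤ (- ⟦ f ⟧ℤ))
                     (cong₂ ℚ._+_ (ι-⟦⟧ e) (trans (ι-neg ⟦ f ⟧ℤ) (cong ℚ.-_ (ι-⟦⟧ f))))
ι-⟦⟧ (e ⊗ f) = trans (ι-* ⟦ e ⟧ℤ ⟦ f ⟧ℤ) (cong₂ ℚ._*_ (ι-⟦⟧ e) (ι-⟦⟧ f))

ι-cong-⟦⟧ : ∀ e f → ⟦ e ⟧ℤ ≡ ⟦ f ⟧ℤ → ⟦ e ⟧ℚ ≡ ⟦ f ⟧ℚ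
ι-cong-⟦⟧ e f e≡f = trans (sym (ι-⟦⟧ e)) (trans (cong ι e≡f) (ι-⟦⟧ f))

⟦⟧ℚ-≢0 : ∀ e → ⟦ e ⟧ℤ ≢ 0ℤ → ⟦ e ⟧ℚ ≢ 0ℚ
⟦⟧ℚ-≢0 e e≢0 = subst (_≢ 0ℚ) (ι-⟦⟧ e) (ι-≢0 ⟦ e ⟧ℤ e≢0)

frac*⟦⟧≡ι : ∀ n e → ⟦ e ⟧ℤ ≢ 0ℤ → frac n ⟦ e ⟧ℤ ℚ.* ⟦ e ⟧ℚ ≡ ι n
frac*⟦⟧≡ι n e e≢0 = trans (cong (frac n ⟦ e ⟧ℤ ℚ.*_) (sym (ι-⟦⟧ e))) (frac*ι≡ι n ⟦ e ⟧ℤ e≢0)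

frac-+ : ∀ m n d → d ≢ 0ℤ → frac (m + n) d ≡ frac m d ℚ.+ frac n d
frac-+ m n d d≢0 = *ι-cancelʳ d d≢0 (begin
  frac (m + n) d ℚ.* ι d                                ≡⟨ frac*ι≡ι (m + n) d d≢0 ⟩
  ι (m + n)                                             ≡⟨ ι-+ m n ⟩
  ι m ℚ.+ ι n                                           ≡⟨ cong₂ ℚ._+_ (frac*ι≡ι m d d≢0) (frac*ι≡ι n d d≢0) ⟨
  frac m d ℚ.* ι d ℚ.+ frac n d ℚ.* ι d                 ≡⟨ ℚ.*-distribʳ-+ (ι d) (frac m d) (frac n d) ⟨
  (frac m d ℚ.+ frac n d) ℚ.* ι d                       ∎)
  where open ≡-Reasoning

infix 4 _∣ℤ₍ₚ₎_

record _∣ℤ₍ₚ₎_ (p : ℕ) (x : ℚ) : Set where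
  constructor mk∣ℤ₍ₚ₎
  field
    numerator denominator   : ℤ
    p∣numerator             : + p ∣ numerator
    p∤denominator           : ¬ + p ∣ denominator
    x*denominator≡numerator : x ℚ.* ι denominator ≡ ι numerator

∣ℤ₍ₚ₎-0 : ∀ {p} → Prime p → p ∣ℤ₍ₚ₎ 0ℚ
∣ℤ₍ₚ₎-0 p-prime = mk∣ℤ₍ₚ₎ 0ℤ 1ℤ (divides 0ℤ refl) (p∤1 p-prime) refl

∣ℤ₍ₚ₎-+ : ∀ {p} → Prime p → ∀ {x y} → p ∣ℤ₍ₚ₎ x → p ∣ℤ₍ₚ₎ y → p ∣ℤ₍ₚ₎ (x ℚ.+ y)
∣ℤ₍ₚ₎-+ p-prime {x} {y} (mk∣ℤ₍ₚ₎ m d p∣m p∤d xd≡m) (mk∣ℤ₍ₚ₎ n e p∣n p∤e ye≡n) =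
  mk∣ℤ₍ₚ₎ (m * e + n * d) (d * e) (∣m∣n⇒∣m+n (∣m⇒∣m*n e p∣m) (∣m⇒∣m*n d p∣n))
          (p∤m∧p∤n⇒p∤m*n p-prime p∤d p∤e)
    (begin
      (x ℚ.+ y) ℚ.* ι (d * e)                        ≡⟨ cong ((x ℚ.+ y) ℚ.*_) (ι-* d e) ⟩
      (x ℚ.+ y) ℚ.* (ι d ℚ.* ι e)                    ≡⟨ distrib x y (ι d) (ι e) ⟩
      (x ℚ.* ι d) ℚ.* ι e ℚ.+ (y ℚ.* ι e) ℚ.* ι d   ≡⟨ cong₂ (λ s t → s ℚ.* ι e ℚ.+ t ℚ.* ι d) xd≡m ye≡n ⟩
      ι m ℚ.* ι e ℚ.+ ι n ℚ.* ι d                    ≡⟨ ι-⟦⟧ (⌜ m ⌝ ⊗ ⌜ e ⌝ ⊕ ⌜ n ⌝ ⊗ ⌜ d ⌝) ⟨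
      ι (m * e + n * d)                              ∎)
  where
  open ≡-Reasoning
  distrib : ∀ x y d e → (x ℚ.+ y) ℚ.* (d ℚ.* e) ≡ (x ℚ.* d) ℚ.* e ℚ.+ (y ℚ.* e) ℚ.* d
  distrib = RingSolver.solve-∀ ℚ-ring

∣ℤ₍ₚ₎-neg : ∀ {p x} → p ∣ℤ₍ₚ₎ x → p ∣ℤ₍ₚ₎ (ℚ.- x)
∣ℤ₍ₚ₎-neg {x = x} (mk∣ℤ₍ₚ₎ m d p∣m p∤d xd≡m) =
  mk∣ℤ₍ₚ₎ (- m) d (∣m⇒∣-m p∣m) p∤d
    (trans (sym (ℚ.neg-distribˡ-* x (ι d))) (trans (cong ℚ.-_ xd≡m) (sym (ι-neg m))))

∣ℤ₍ₚ₎-- : ∀ {p} → Prime p → ∀ {x y} → p ∣ℤ₍ₚ₎ x → p ∣ℤ₍ₚ₎ y → p ∣ℤ₍ₚ₎ (x ℚ.- y)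
∣ℤ₍ₚ₎-- p-prime p∣x p∣y = ∣ℤ₍ₚ₎-+ p-prime p∣x (∣ℤ₍ₚ₎-neg p∣y)

∣ℤ₍ₚ₎-frac* : ∀ {p} → Prime p → ∀ {x} n d → ¬ + p ∣ d → p ∣ℤ₍ₚ₎ x → p ∣ℤ₍ₚ₎ (frac n d ℚ.* x)
∣ℤ₍ₚ₎-frac* p-prime {x} n d p∤d (mk∣ℤ₍ₚ₎ m e p∣m p∤e xe≡m) =
  mk∣ℤ₍ₚ₎ (n * m) (d * e) (∣n⇒∣m*n n p∣m) (p∤m∧p∤n⇒p∤m*n p-prime p∤d p∤e)
    (begin
      (frac n d ℚ.* x) ℚ.* ι (d * e)            ≡⟨ cong ((frac n d ℚ.* x) ℚ.*_) (ι-* d e) ⟩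
      (frac n d ℚ.* x) ℚ.* (ι d ℚ.* ι e)        ≡⟨ regroup (frac n d) x (ι d) (ι e) ⟩
      (frac n d ℚ.* ι d) ℚ.* (x ℚ.* ι e)        ≡⟨ cong₂ ℚ._*_ (frac*ι≡ι n d (p∤⇒≢0 p∤d)) xe≡m ⟩
      ι n ℚ.* ι m                                ≡⟨ ι-* n m ⟨
      ι (n * m)                                  ∎)
  where
  open ≡-Reasoning
  regroup : ∀ f x d e → (f ℚ.* x) ℚ.* (d ℚ.* e) ≡ (f ℚ.* d) ℚ.* (x ℚ.* e)
  regroup = RingSolver.solve-∀ ℚ-ring

*ι≡ι⇒↥*≡*↧ : ∀ z m n → z ℚ.* ι m ≡ ι n → ℚ.↥ z * m ≡ n * ℚ.↧ z
*ι≡ι⇒↥*≡*↧ z@(mkℚ k d _) m n zm≡n with (begin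
  mkℚᵘ k d ℚᵘ.* mkℚᵘ m 0             ≈⟨ ℚᵘ.*-cong (ℚᵘ.≃-refl {mkℚᵘ k d}) (toℚᵘ-ι m) ⟨
  ℚ.toℚᵘ z ℚᵘ.* ℚ.toℚᵘ (ι m)         ≈⟨ ℚ.toℚᵘ-homo-* z (ι m) ⟨
  ℚ.toℚᵘ (z ℚ.* ι m)                  ≈⟨ ℚ.toℚᵘ-cong zm≡n ⟩
  ℚ.toℚᵘ (ι n)                        ≈⟨ toℚᵘ-ι n ⟩
  mkℚᵘ n 0                            ∎)
  where open ℚᵘ.≃-Reasoning
... | *≡* eq = trans (sym (ℤ.*-identityʳ (k * m))) (trans eq (cong (λ j → n * + suc j) (ℕ.*-identityʳ d)))

∣ℤ₍ₚ₎⇒p∣↥∧p∤↧ : ∀ {p} → Prime p → ∀ {z} → p ∣ℤ₍ₚ₎ z → p ℕ.∣ ℤ.∣ ℚ.↥ z ∣ × ¬ p ℕ.∣ ℚ.↧ₙ z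
∣ℤ₍ₚ₎⇒p∣↥∧p∤↧ {p} p-prime {z@(mkℚ k d coprime)} (mk∣ℤ₍ₚ₎ m e p∣m p∤e ze≡m) = p∣k , p∤d
  where
  p∣ke : + p ∣ k * e
  p∣ke = subst (+ p ∣_) (sym (*ι≡ι⇒↥*≡*↧ z e m ze≡m)) (∣m⇒∣m*n (+ suc d) p∣m)
  p∣k : p ℕ.∣ ℤ.∣ k ∣
  p∣k with p∣m*n⇒p∣m⊎p∣n p-prime {k} {e} p∣ke
  ... | inj₁ p∣k = ∣⇒∣ᵤ p∣k
  ... | inj₂ p∣e = contradiction p∣e p∤e
  p∤d : ¬ p ℕ.∣ suc d
  p∤d p∣d = ℕ.nonTrivial⇒≢1 {{prime⇒nonTrivial p-prime}} (recompute coprime (p∣k , p∣d))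

∣ℤ₍ₚ₎-[-a]ᵏ/k+C[p,k]aᵏ/p : ∀ {n} → Prime (suc n) → ∀ a j → j ℕ.< n →
  suc n ∣ℤ₍ₚ₎ (frac ((- a) ^ suc j) (+ suc j) ℚ.+ frac (binomialTerm a (suc n) (suc j)) (+ suc n))
∣ℤ₍ₚ₎-[-a]ᵏ/k+C[p,k]aᵏ/p {n} p-prime a j j<n =
  mk∣ℤ₍ₚ₎ (a ^ suc j * (+ (n C j) - -1ℤ ^ j)) (+ suc j)
          (∣n⇒∣m*n (a ^ suc j) (p∣[p-1]Ck-[-1]^k p-prime (ℕ.<⇒≤ j<n)))
          (λ p∣k → contradiction (ℕ.∣⇒≤ (∣⇒∣ᵤ p∣k)) (ℕ.<⇒≱ (s≤s j<n)))
          (*ι-cancelʳ (+ suc n) (λ ()) (begin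
    ((t ℚ.+ b) ℚ.* ι (+ suc j)) ℚ.* ι (+ suc n)
      ≡⟨ regroup t b (ι (+ suc j)) (ι (+ suc n)) ⟩
    (t ℚ.* ι (+ suc j)) ℚ.* ι (+ suc n) ℚ.+ (b ℚ.* ι (+ suc n)) ℚ.* ι (+ suc j)
      ≡⟨ cong₂ (λ x y → x ℚ.* ι (+ suc n) ℚ.+ y ℚ.* ι (+ suc j))
               (frac*ι≡ι ((- a) ^ suc j) (+ suc j) (λ ()))
               (frac*ι≡ι (binomialTerm a (suc n) (suc j)) (+ suc n) (λ ())) ⟩
    ι ((- a) ^ suc j) ℚ.* ι (+ suc n) ℚ.+ ι (binomialTerm a (suc n) (suc j)) ℚ.* ι (+ suc j)
      ≡⟨ ι-⟦⟧ (⌜ (- a) ^ suc j ⌝ ⊗ ⌜ + suc n ⌝ ⊕ ⌜ binomialTerm a (suc n) (suc j) ⌝ ⊗ ⌜ + suc j ⌝) ⟨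
    ι ((- a) ^ suc j * + suc n + binomialTerm a (suc n) (suc j) * + suc j)
      ≡⟨ cong ι ([-a]ᵏp+C[p,k]aᵏk≡aᵏ[C[p-1,k-1]-[-1]ᵏ⁻¹]p a n j) ⟩
    ι ((a ^ suc j * (+ (n C j) - -1ℤ ^ j)) * + suc n)
      ≡⟨ ι-* (a ^ suc j * (+ (n C j) - -1ℤ ^ j)) (+ suc n) ⟩
    ι (a ^ suc j * (+ (n C j) - -1ℤ ^ j)) ℚ.* ι (+ suc n) ∎))
  where
  open ≡-Reasoning
  t = frac ((- a) ^ suc j) (+ suc j)
  b = frac (binomialTerm a (suc n) (suc j)) (+ suc n)
  regroup : ∀ t b k p → ((t ℚ.+ b) ℚ.* k) ℚ.* p ≡ (t ℚ.* k) ℚ.* p ℚ.+ (b ℚ.* p) ℚ.* k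
  regroup = RingSolver.solve-∀ ℚ-ring

∣ℤ₍ₚ₎-Ksum+classSum : ∀ {n} → Prime (suc n) → ∀ a r m → m ℕ.≤ n →
  suc n ∣ℤ₍ₚ₎ (Ksum a r m ℚ.+ frac (classSum (binomialTerm a (suc n)) r m) (+ suc n))
∣ℤ₍ₚ₎-Ksum+classSum {n} p-prime a r zero    _ =
  subst (suc n ∣ℤ₍ₚ₎_) (sym (cong (0ℚ ℚ.+_) (ℚ.0/n≡0 (suc n)))) (∣ℤ₍ₚ₎-0 p-prime)
∣ℤ₍ₚ₎-Ksum+classSum {n} p-prime a r (suc m) m<n with suc m % 4 ℕ.≟ r % 4
... | yes _ = subst (suc n ∣ℤ₍ₚ₎_) (sym split)
                (∣ℤ₍ₚ₎-+ p-prime (∣ℤ₍ₚ₎-Ksum+classSum p-prime a r m (ℕ.<⇒≤ m<n))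
                                 (∣ℤ₍ₚ₎-[-a]ᵏ/k+C[p,k]aᵏ/p p-prime a m m<n))
  where
  κ = Ksum a r m
  t = frac ((- a) ^ suc m) (+ suc m)
  α = classSum (binomialTerm a (suc n)) r m
  g = binomialTerm a (suc n) (suc m)
  split : (κ ℚ.+ t) ℚ.+ frac (α + g) (+ suc n) ≡ (κ ℚ.+ frac α (+ suc n)) ℚ.+ (t ℚ.+ frac g (+ suc n))
  split = trans (cong ((κ ℚ.+ t) ℚ.+_) (frac-+ α g (+ suc n) (λ ())))
                (interchange κ t (frac α (+ suc n)) (frac g (+ suc n)))
    where
    interchange : ∀ w x y z → (w ℚ.+ x) ℚ.+ (y ℚ.+ z) ≡ (w ℚ.+ y) ℚ.+ (x ℚ.+ z)
    interchange = RingSolver.solve-∀ ℚ-ring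
... | no _  = ∣ℤ₍ₚ₎-Ksum+classSum p-prime a r m (ℕ.<⇒≤ m<n)

-- lucas-identity₁ divided by 2a(a²+1) p, with P = p, U = uₚ₋₁/p, Fermat quotients Q and αᵣ = Aᵣ/p.
lucas-quotient₁ : ∀ a P U G H F Q Q₊ Q₋ α₀ α₁ {u y y₊ y₋ A₀ A₁} →
  P ≢ 0ℚ → ι (+ 2) ℚ.* a ℚ.* (a ℚ.* a ℚ.+ 1ℚ) ≢ 0ℚ →
  U ℚ.* P ≡ u → Q ℚ.* P ≡ y → Q₊ ℚ.* P ≡ y₊ → Q₋ ℚ.* P ≡ y₋ → α₀ ℚ.* P ≡ A₀ → α₁ ℚ.* P ≡ A₁ →
  G ℚ.* (a ℚ.* a ℚ.+ 1ℚ) ≡ ι (+ 2) →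
  H ℚ.* (ι (+ 2) ℚ.* a ℚ.* (a ℚ.* a ℚ.+ 1ℚ)) ≡ a ℚ.* a ℚ.- 1ℚ →
  F ℚ.* (a ℚ.* (a ℚ.* a ℚ.+ 1ℚ)) ≡ ι (+ 2) →
  ι (+ 2) ℚ.* a ℚ.* (a ℚ.* a ℚ.+ 1ℚ) ℚ.* u
    ≡ ι (+ 4) ℚ.* a ℚ.* y ℚ.+ (a ℚ.* a ℚ.- 1ℚ) ℚ.* (y₊ ℚ.- y₋) ℚ.+ ι (+ 4) ℚ.* (A₁ ℚ.- a ℚ.* A₀) →
  U ≡ G ℚ.* Q ℚ.+ H ℚ.* (Q₊ ℚ.- Q₋) ℚ.+ F ℚ.* (α₁ ℚ.- a ℚ.* α₀)
lucas-quotient₁ a P U G H F Q Q₊ Q₋ α₀ α₁ P≢0 D≢0 refl refl refl refl refl refl hG hH hF ident =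
  *-cancelʳ-≢0 P P≢0 (*-cancelʳ-≢0 _ D≢0 (begin
    U ℚ.* P ℚ.* (ι (+ 2) ℚ.* a ℚ.* (a ℚ.* a ℚ.+ 1ℚ))
      ≡⟨ RingSolver.solve (a ∷ P ∷ U ∷ []) ℚ-ring ⟩
    ι (+ 2) ℚ.* a ℚ.* (a ℚ.* a ℚ.+ 1ℚ) ℚ.* (U ℚ.* P)
      ≡⟨ ident ⟩
    ι (+ 4) ℚ.* a ℚ.* (Q ℚ.* P) ℚ.+ (a ℚ.* a ℚ.- 1ℚ) ℚ.* (Q₊ ℚ.* P ℚ.- Q₋ ℚ.* P)
      ℚ.+ ι (+ 4) ℚ.* (α₁ ℚ.* P ℚ.- a ℚ.* (α₀ ℚ.* P))
      ≡⟨ RingSolver.solve (a ∷ P ∷ Q ∷ Q₊ ∷ Q₋ ∷ α₀ ∷ α₁ ∷ []) ℚ-ring ⟩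
    ι (+ 2) ℚ.* (ι (+ 2) ℚ.* a ℚ.* (Q ℚ.* P)) ℚ.+ (a ℚ.* a ℚ.- 1ℚ) ℚ.* (Q₊ ℚ.* P ℚ.- Q₋ ℚ.* P)
      ℚ.+ ι (+ 2) ℚ.* (ι (+ 2) ℚ.* (α₁ ℚ.* P ℚ.- a ℚ.* (α₀ ℚ.* P)))
      ≡⟨ cong₂ (λ g f → g ℚ.* (ι (+ 2) ℚ.* a ℚ.* (Q ℚ.* P)) ℚ.+ (a ℚ.* a ℚ.- 1ℚ) ℚ.* (Q₊ ℚ.* P ℚ.- Q₋ ℚ.* P)
                          ℚ.+ f ℚ.* (ι (+ 2) ℚ.* (α₁ ℚ.* P ℚ.- a ℚ.* (α₀ ℚ.* P)))) hG hF ⟨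
    G ℚ.* (a ℚ.* a ℚ.+ 1ℚ) ℚ.* (ι (+ 2) ℚ.* a ℚ.* (Q ℚ.* P)) ℚ.+ (a ℚ.* a ℚ.- 1ℚ) ℚ.* (Q₊ ℚ.* P ℚ.- Q₋ ℚ.* P)
      ℚ.+ F ℚ.* (a ℚ.* (a ℚ.* a ℚ.+ 1ℚ)) ℚ.* (ι (+ 2) ℚ.* (α₁ ℚ.* P ℚ.- a ℚ.* (α₀ ℚ.* P)))
      ≡⟨ cong (λ h → G ℚ.* (a ℚ.* a ℚ.+ 1ℚ) ℚ.* (ι (+ 2) ℚ.* a ℚ.* (Q ℚ.* P)) ℚ.+ h ℚ.* (Q₊ ℚ.* P ℚ.- Q₋ ℚ.* P)
                     ℚ.+ F ℚ.* (a ℚ.* (a ℚ.* a ℚ.+ 1ℚ)) ℚ.* (ι (+ 2) ℚ.* (α₁ ℚ.* P ℚ.- a ℚ.* (α₀ ℚ.* P)))) hH ⟨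
    G ℚ.* (a ℚ.* a ℚ.+ 1ℚ) ℚ.* (ι (+ 2) ℚ.* a ℚ.* (Q ℚ.* P))
      ℚ.+ H ℚ.* (ι (+ 2) ℚ.* a ℚ.* (a ℚ.* a ℚ.+ 1ℚ)) ℚ.* (Q₊ ℚ.* P ℚ.- Q₋ ℚ.* P)
      ℚ.+ F ℚ.* (a ℚ.* (a ℚ.* a ℚ.+ 1ℚ)) ℚ.* (ι (+ 2) ℚ.* (α₁ ℚ.* P ℚ.- a ℚ.* (α₀ ℚ.* P)))
      ≡⟨ RingSolver.solve (a ∷ P ∷ G ∷ H ∷ F ∷ Q ∷ Q₊ ∷ Q₋ ∷ α₀ ∷ α₁ ∷ []) ℚ-ring ⟩
    (G ℚ.* Q ℚ.+ H ℚ.* (Q₊ ℚ.- Q₋) ℚ.+ F ℚ.* (α₁ ℚ.- a ℚ.* α₀)) ℚ.* P ℚ.* (ι (+ 2) ℚ.* a ℚ.* (a ℚ.* a ℚ.+ 1ℚ)) ∎))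
  where open ≡-Reasoning

lucas-quotient₃ : ∀ a P U H₊ H₋ F Q₊ Q₋ α₀ α₁ {u y₊ y₋ A₀ A₁} →
  P ≢ 0ℚ → ι (+ 2) ℚ.* a ≢ 0ℚ →
  U ℚ.* P ≡ u → Q₊ ℚ.* P ≡ y₊ → Q₋ ℚ.* P ≡ y₋ → α₀ ℚ.* P ≡ A₀ → α₁ ℚ.* P ≡ A₁ →
  H₊ ℚ.* (ι (+ 2) ℚ.* a) ≡ (a ℚ.+ 1ℚ) ℚ.* (a ℚ.+ 1ℚ) →
  H₋ ℚ.* (ι (+ 2) ℚ.* a) ≡ (a ℚ.- 1ℚ) ℚ.* (a ℚ.- 1ℚ) →
  F ℚ.* a ≡ ι (+ 2) →
  ι (+ 2) ℚ.* a ℚ.* u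
    ≡ (a ℚ.- 1ℚ) ℚ.* (a ℚ.- 1ℚ) ℚ.* y₋ ℚ.- (a ℚ.+ 1ℚ) ℚ.* (a ℚ.+ 1ℚ) ℚ.* y₊ ℚ.+ ι (+ 4) ℚ.* (A₁ ℚ.+ a ℚ.* A₀) →
  U ≡ ℚ.- (H₊ ℚ.* Q₊) ℚ.+ H₋ ℚ.* Q₋ ℚ.+ F ℚ.* (α₁ ℚ.+ a ℚ.* α₀)
lucas-quotient₃ a P U H₊ H₋ F Q₊ Q₋ α₀ α₁ P≢0 D≢0 refl refl refl refl refl hH₊ hH₋ hF ident =
  *-cancelʳ-≢0 P P≢0 (*-cancelʳ-≢0 _ D≢0 (begin
    U ℚ.* P ℚ.* (ι (+ 2) ℚ.* a)
      ≡⟨ RingSolver.solve (a ∷ P ∷ U ∷ []) ℚ-ring ⟩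
    ι (+ 2) ℚ.* a ℚ.* (U ℚ.* P)
      ≡⟨ ident ⟩
    (a ℚ.- 1ℚ) ℚ.* (a ℚ.- 1ℚ) ℚ.* (Q₋ ℚ.* P) ℚ.- (a ℚ.+ 1ℚ) ℚ.* (a ℚ.+ 1ℚ) ℚ.* (Q₊ ℚ.* P)
      ℚ.+ ι (+ 4) ℚ.* (α₁ ℚ.* P ℚ.+ a ℚ.* (α₀ ℚ.* P))
      ≡⟨ RingSolver.solve (a ∷ P ∷ Q₊ ∷ Q₋ ∷ α₀ ∷ α₁ ∷ []) ℚ-ring ⟩
    (a ℚ.- 1ℚ) ℚ.* (a ℚ.- 1ℚ) ℚ.* (Q₋ ℚ.* P) ℚ.- (a ℚ.+ 1ℚ) ℚ.* (a ℚ.+ 1ℚ) ℚ.* (Q₊ ℚ.* P)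
      ℚ.+ ι (+ 2) ℚ.* (ι (+ 2) ℚ.* (α₁ ℚ.* P ℚ.+ a ℚ.* (α₀ ℚ.* P)))
      ≡⟨ cong₂ (λ h₋ h₊ → h₋ ℚ.* (Q₋ ℚ.* P) ℚ.- h₊ ℚ.* (Q₊ ℚ.* P)
                          ℚ.+ ι (+ 2) ℚ.* (ι (+ 2) ℚ.* (α₁ ℚ.* P ℚ.+ a ℚ.* (α₀ ℚ.* P)))) hH₋ hH₊ ⟨
    H₋ ℚ.* (ι (+ 2) ℚ.* a) ℚ.* (Q₋ ℚ.* P) ℚ.- H₊ ℚ.* (ι (+ 2) ℚ.* a) ℚ.* (Q₊ ℚ.* P)
      ℚ.+ ι (+ 2) ℚ.* (ι (+ 2) ℚ.* (α₁ ℚ.* P ℚ.+ a ℚ.* (α₀ ℚ.* P)))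
      ≡⟨ cong (λ f → H₋ ℚ.* (ι (+ 2) ℚ.* a) ℚ.* (Q₋ ℚ.* P) ℚ.- H₊ ℚ.* (ι (+ 2) ℚ.* a) ℚ.* (Q₊ ℚ.* P)
                     ℚ.+ f ℚ.* (ι (+ 2) ℚ.* (α₁ ℚ.* P ℚ.+ a ℚ.* (α₀ ℚ.* P)))) hF ⟨
    H₋ ℚ.* (ι (+ 2) ℚ.* a) ℚ.* (Q₋ ℚ.* P) ℚ.- H₊ ℚ.* (ι (+ 2) ℚ.* a) ℚ.* (Q₊ ℚ.* P)
      ℚ.+ F ℚ.* a ℚ.* (ι (+ 2) ℚ.* (α₁ ℚ.* P ℚ.+ a ℚ.* (α₀ ℚ.* P)))
      ≡⟨ RingSolver.solve (a ∷ P ∷ H₊ ∷ H₋ ∷ F ∷ Q₊ ∷ Q₋ ∷ α₀ ∷ α₁ ∷ []) ℚ-ring ⟩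
    (ℚ.- (H₊ ℚ.* Q₊) ℚ.+ H₋ ℚ.* Q₋ ℚ.+ F ℚ.* (α₁ ℚ.+ a ℚ.* α₀)) ℚ.* P ℚ.* (ι (+ 2) ℚ.* a) ∎))
  where open ≡-Reasoning

module _ (a : ℤ) (n : ℕ) (p-prime : Prime (suc n)) (p≢2 : suc n ≢ 2)
         (p∤a[a⁴-1] : ¬ (+ suc n) ℤD.∣ (a * (a ^ 4 - 1ℤ))) where

  private
    p = suc n
    A = binomialClasses a p

    α : ℕ → ℚ
    α r = frac (A r) (+ p)

    a+1 = ⌜ a ⌝ ⊕ ⌜ 1ℤ ⌝
    a-1 = ⌜ a ⌝ ⊖ ⌜ 1ℤ ⌝
    c   = ⌜ a ⌝ ⊗ ⌜ a ⌝ ⊕ ⌜ 1ℤ ⌝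
    2a  = ⌜ + 2 ⌝ ⊗ ⌜ a ⌝

    F₁ G₁ H₁ F₃ H₊ H₋ : ℚ
    F₁ = frac (+ 2) (a * (a * a + 1ℤ))
    G₁ = frac (+ 2) (a * a + 1ℤ)
    H₁ = frac (a * a - 1ℤ) (+ 2 * a * (a * a + 1ℤ))
    F₃ = frac (+ 2) a
    H₊ = frac ((a + 1ℤ) * (a + 1ℤ)) (+ 2 * a)
    H₋ = frac ((a - 1ℤ) * (a - 1ℤ)) (+ 2 * a)

    p∤a : ¬ + p ∣ a
    p∤a = p∤a[a⁴-1]⇒p∤a a p∤a[a⁴-1]

    p∤c : ¬ + p ∣ ⟦ c ⟧ℤ
    p∤c = p∤a[a⁴-1]⇒p∤a²+1 a p∤a[a⁴-1]

    p∤2a : ¬ + p ∣ ⟦ 2a ⟧ℤ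
    p∤2a = p∤m∧p∤n⇒p∤m*n p-prime (p∤2 p-prime p≢2) p∤a

    p∤ac : ¬ + p ∣ ⟦ ⌜ a ⌝ ⊗ c ⟧ℤ
    p∤ac = p∤m∧p∤n⇒p∤m*n p-prime p∤a p∤c

    p∤2ac : ¬ + p ∣ ⟦ 2a ⊗ c ⟧ℤ
    p∤2ac = p∤m∧p∤n⇒p∤m*n p-prime p∤2a p∤c

    frac/p*p : ∀ m → frac m (+ p) ℚ.* ι (+ p) ≡ ι m
    frac/p*p m = frac*ι≡ι m (+ p) (λ ())

    K+α : ∀ r → p ∣ℤ₍ₚ₎ K p r a ℚ.+ α r
    K+α r = ∣ℤ₍ₚ₎-Ksum+classSum p-prime a r n ℕ.≤-refl

  u[p-1]/p≡ : p % 4 ≡ 1 →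
    frac (u a n) (+ p) ≡ G₁ ℚ.* q p a ℚ.+ H₁ ℚ.* (q p (a + 1ℤ) ℚ.- q p (a - 1ℤ)) ℚ.+ F₁ ℚ.* (α 1 ℚ.- ι a ℚ.* α 0)
  u[p-1]/p≡ p≡1 =
    lucas-quotient₁ (ι a) (ι (+ p)) (frac (u a n) (+ p)) G₁ H₁ F₁ (q p a) (q p (a + 1ℤ)) (q p (a - 1ℤ)) (α 0) (α 1)
      (ι-≢0 (+ p) (λ ())) (⟦⟧ℚ-≢0 (2a ⊗ c) (p∤⇒≢0 p∤2ac))
      (frac/p*p (u a n)) (frac/p*p (a ^ n - 1ℤ)) (frac/p*p ((a + 1ℤ) ^ n - 1ℤ)) (frac/p*p ((a - 1ℤ) ^ n - 1ℤ))
      (frac/p*p (A 0)) (frac/p*p (A 1))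
      (frac*⟦⟧≡ι (+ 2) c (p∤⇒≢0 p∤c))
      (trans (frac*⟦⟧≡ι (a * a - 1ℤ) (2a ⊗ c) (p∤⇒≢0 p∤2ac)) (ι-⟦⟧ (⌜ a ⌝ ⊗ ⌜ a ⌝ ⊖ ⌜ 1ℤ ⌝)))
      (frac*⟦⟧≡ι (+ 2) (⌜ a ⌝ ⊗ c) (p∤⇒≢0 p∤ac))
      (ι-cong-⟦⟧ (2a ⊗ c ⊗ ⌜ u a n ⌝)
                 (⌜ + 4 ⌝ ⊗ ⌜ a ⌝ ⊗ ⌜ a ^ n - 1ℤ ⌝
                  ⊕ (⌜ a ⌝ ⊗ ⌜ a ⌝ ⊖ ⌜ 1ℤ ⌝) ⊗ (⌜ (a + 1ℤ) ^ n - 1ℤ ⌝ ⊖ ⌜ (a - 1ℤ) ^ n - 1ℤ ⌝)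
                  ⊕ ⌜ + 4 ⌝ ⊗ (⌜ A 1 ⌝ ⊖ ⌜ a ⌝ ⊗ ⌜ A 0 ⌝))
                 (lucas-identity-p≡1 a n p≡1))

  u[p+1]/p≡ : p % 4 ≡ 3 →
    frac (u a (suc p)) (+ p) ≡ ℚ.- (H₊ ℚ.* q p (a + 1ℤ)) ℚ.+ H₋ ℚ.* q p (a - 1ℤ) ℚ.+ F₃ ℚ.* (α 1 ℚ.+ ι a ℚ.* α 0)
  u[p+1]/p≡ p≡3 =
    lucas-quotient₃ (ι a) (ι (+ p)) (frac (u a (suc p)) (+ p)) H₊ H₋ F₃ (q p (a + 1ℤ)) (q p (a - 1ℤ)) (α 0) (α 1)
      (ι-≢0 (+ p) (λ ())) (⟦⟧ℚ-≢0 2a (p∤⇒≢0 p∤2a))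
      (frac/p*p (u a (suc p))) (frac/p*p ((a + 1ℤ) ^ n - 1ℤ)) (frac/p*p ((a - 1ℤ) ^ n - 1ℤ))
      (frac/p*p (A 0)) (frac/p*p (A 1))
      (trans (frac*⟦⟧≡ι ⟦ a+1 ⊗ a+1 ⟧ℤ 2a (p∤⇒≢0 p∤2a)) (ι-⟦⟧ (a+1 ⊗ a+1)))
      (trans (frac*⟦⟧≡ι ⟦ a-1 ⊗ a-1 ⟧ℤ 2a (p∤⇒≢0 p∤2a)) (ι-⟦⟧ (a-1 ⊗ a-1)))
      (frac*ι≡ι (+ 2) a (p∤⇒≢0 p∤a))
      (ι-cong-⟦⟧ (2a ⊗ ⌜ u a (suc p) ⌝)
                 (a-1 ⊗ a-1 ⊗ ⌜ (a - 1ℤ) ^ n - 1ℤ ⌝ ⊖ a+1 ⊗ a+1 ⊗ ⌜ (a + 1ℤ) ^ n - 1ℤ ⌝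
                  ⊕ ⌜ + 4 ⌝ ⊗ (⌜ A 1 ⌝ ⊕ ⌜ a ⌝ ⊗ ⌜ A 0 ⌝))
                 (lucas-identity-p≡3 a n p≡3))

  case-p≡1 : p % 4 ≡ 1 →
    frac (u a n) (+ p)
      ≡ F₁ ℚ.* (ι a ℚ.* K p 0 a ℚ.- K p 1 a) ℚ.+ G₁ ℚ.* q p a ℚ.+ H₁ ℚ.* (q p (a + 1ℤ) ℚ.- q p (a - 1ℤ))
      [modℚ p ]
  case-p≡1 p≡1 = ∣ℤ₍ₚ₎⇒p∣↥∧p∤↧ p-prime (subst (p ∣ℤ₍ₚ₎_) (sym difference) small)
    where
    RHS = F₁ ℚ.* (ι a ℚ.* K p 0 a ℚ.- K p 1 a) ℚ.+ G₁ ℚ.* q p a ℚ.+ H₁ ℚ.* (q p (a + 1ℤ) ℚ.- q p (a - 1ℤ))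
    regroup : ∀ G H F Q Q₊ Q₋ α₀ α₁ K₀ K₁ a →
      (G ℚ.* Q ℚ.+ H ℚ.* (Q₊ ℚ.- Q₋) ℚ.+ F ℚ.* (α₁ ℚ.- a ℚ.* α₀))
        ℚ.- (F ℚ.* (a ℚ.* K₀ ℚ.- K₁) ℚ.+ G ℚ.* Q ℚ.+ H ℚ.* (Q₊ ℚ.- Q₋))
      ≡ F ℚ.* ((K₁ ℚ.+ α₁) ℚ.- a ℚ.* (K₀ ℚ.+ α₀))
    regroup = RingSolver.solve-∀ ℚ-ring
    difference : frac (u a n) (+ p) ℚ.- RHS ≡ F₁ ℚ.* ((K p 1 a ℚ.+ α 1) ℚ.- ι a ℚ.* (K p 0 a ℚ.+ α 0))
    difference = trans (cong (ℚ._- RHS) (u[p-1]/p≡ p≡1))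
                       (regroup G₁ H₁ F₁ (q p a) (q p (a + 1ℤ)) (q p (a - 1ℤ)) (α 0) (α 1) (K p 0 a) (K p 1 a) (ι a))
    small : p ∣ℤ₍ₚ₎ F₁ ℚ.* ((K p 1 a ℚ.+ α 1) ℚ.- ι a ℚ.* (K p 0 a ℚ.+ α 0))
    small = ∣ℤ₍ₚ₎-frac* p-prime (+ 2) _ p∤ac
              (∣ℤ₍ₚ₎-- p-prime (K+α 1) (∣ℤ₍ₚ₎-frac* p-prime a 1ℤ (p∤1 p-prime) (K+α 0)))

  case-p≡3 : p % 4 ≡ 3 →
    frac (u a (suc p)) (+ p)
      ≡ ℚ.- (F₃ ℚ.* (ι a ℚ.* K p 0 a ℚ.+ K p 1 a)) ℚ.- H₊ ℚ.* q p (a + 1ℤ) ℚ.+ H₋ ℚ.* q p (a - 1ℤ)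
      [modℚ p ]
  case-p≡3 p≡3 = ∣ℤ₍ₚ₎⇒p∣↥∧p∤↧ p-prime (subst (p ∣ℤ₍ₚ₎_) (sym difference) small)
    where
    RHS = ℚ.- (F₃ ℚ.* (ι a ℚ.* K p 0 a ℚ.+ K p 1 a)) ℚ.- H₊ ℚ.* q p (a + 1ℤ) ℚ.+ H₋ ℚ.* q p (a - 1ℤ)
    regroup : ∀ H₊ H₋ F Q₊ Q₋ α₀ α₁ K₀ K₁ a →
      (ℚ.- (H₊ ℚ.* Q₊) ℚ.+ H₋ ℚ.* Q₋ ℚ.+ F ℚ.* (α₁ ℚ.+ a ℚ.* α₀))
        ℚ.- (ℚ.- (F ℚ.* (a ℚ.* K₀ ℚ.+ K₁)) ℚ.- H₊ ℚ.* Q₊ ℚ.+ H₋ ℚ.* Q₋)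
      ≡ F ℚ.* ((K₁ ℚ.+ α₁) ℚ.+ a ℚ.* (K₀ ℚ.+ α₀))
    regroup = RingSolver.solve-∀ ℚ-ring
    difference : frac (u a (suc p)) (+ p) ℚ.- RHS ≡ F₃ ℚ.* ((K p 1 a ℚ.+ α 1) ℚ.+ ι a ℚ.* (K p 0 a ℚ.+ α 0))
    difference = trans (cong (ℚ._- RHS) (u[p+1]/p≡ p≡3))
                       (regroup H₊ H₋ F₃ (q p (a + 1ℤ)) (q p (a - 1ℤ)) (α 0) (α 1) (K p 0 a) (K p 1 a) (ι a))
    small : p ∣ℤ₍ₚ₎ F₃ ℚ.* ((K p 1 a ℚ.+ α 1) ℚ.+ ι a ℚ.* (K p 0 a ℚ.+ α 0))
    small = ∣ℤ₍ₚ₎-frac* p-prime (+ 2) a p∤a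
              (∣ℤ₍ₚ₎-+ p-prime (K+α 1) (∣ℤ₍ₚ₎-frac* p-prime a 1ℤ (p∤1 p-prime) (K+α 0)))

theorem5p2 : (a : ℤ) (p : ℕ) → Prime p → p ≢ 2 →
    ¬ ((+ p) ℤD.∣ (a ℤ.* (a ℤ.^ 4 ℤ.- ℤ.1ℤ))) →
    ((p % 4 ≡ 1) →
      (frac (u a (p ℕ.∸ 1)) (+ p))
        ≡ (frac (+ 2) (a ℤ.* (a ℤ.* a ℤ.+ ℤ.1ℤ)) ℚ.* (frac a ℤ.1ℤ ℚ.* K p 0 a ℚ.- K p 1 a)
           ℚ.+ frac (+ 2) (a ℤ.* a ℤ.+ ℤ.1ℤ) ℚ.* q p a
           ℚ.+ frac (a ℤ.* a ℤ.- ℤ.1ℤ) (+ 2 ℤ.* a ℤ.* (a ℤ.* a ℤ.+ ℤ.1ℤ))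
               ℚ.* (q p (a ℤ.+ ℤ.1ℤ) ℚ.- q p (a ℤ.- ℤ.1ℤ)))
        [modℚ p ])
    × ((p % 4 ≡ 3) →
      (frac (u a (ℕ.suc p)) (+ p))
        ≡ (ℚ.- (frac (+ 2) a ℚ.* (frac a ℤ.1ℤ ℚ.* K p 0 a ℚ.+ K p 1 a))
           ℚ.- frac ((a ℤ.+ ℤ.1ℤ) ℤ.* (a ℤ.+ ℤ.1ℤ)) (+ 2 ℤ.* a) ℚ.* q p (a ℤ.+ ℤ.1ℤ)
           ℚ.+ frac ((a ℤ.- ℤ.1ℤ) ℤ.* (a ℤ.- ℤ.1ℤ)) (+ 2 ℤ.* a) ℚ.* q p (a ℤ.- ℤ.1ℤ))
        [modℚ p ])
theorem5p2 a zero    ()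
theorem5p2 a (suc n) p-prime p≢2 p∤a[a⁴-1] =
  case-p≡1 a n p-prime p≢2 p∤a[a⁴-1] , case-p≡3 a n p-prime p≢2 p∤a[a⁴-1]
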